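{- For all integers $r,s \geq 0$, $\mathcal{B}_{r,s} \neq 0$, except exactly in the cases $(r,s) = (n,0)$ and $(r,s) = (0,n)$ with $n \geq 3$ odd, in which $\mathcal{B}_{r,s}=0$.
   Context: The Bernoulli numbers $\mathbf{B}_n$ are defined by $\frac{t}{e^t-1} = \sum_{n \geq 0} \mathbf{B}_n \frac{t^n}{n!}$ (so $\mathbf{B}_1 = -\tfrac12$). For integers $r,s \geq 0$ define $\mathcal{B}_{r,s} = \sum_{\nu=0}^{r} \binom{r}{\nu} \mathbf{B}_{s+\nu}$. -}

module Defs where

open import Data.Nat as ℕ using (ℕ; zero; suc)
open import Data.Nat.Combinatorics using (_C_)
open import Data.Integer as ℤ using (+_)
open import Data.Rational using (ℚ; 0ℚ; 1ℚ; _+_; _*_; -_; _/_)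
open import Data.List using (List; []; _∷_; _++_; [_]; length)

-- Bernoulli numbers with the convention t/(e^t - 1) = Σ B_n t^n / n!  (so B 1 = -1/2),
-- computed by the standard recurrence
--   B_0 = 1,   B_n = - 1/(n+1) * Σ_{k=0}^{n-1} C(n+1,k) B_k   (n ≥ 1),
-- which is equivalent to the generating function definition.

private
  weighted : ℕ → ℕ → List ℚ → ℚ
  weighted m i []       = 0ℚ
  weighted m i (x ∷ xs) = ((+ (m C i)) / 1) * x + weighted m (suc i) xs

-- bernoulliTable n = [B_0, B_1, …, B_n]
bernoulliTable : ℕ → List ℚ
bernoulliTable zero    = 1ℚ ∷ []
bernoulliTable (suc n) =
  let prev = bernoulliTable n
  in prev ++ [ - ((+ 1 / suc (suc n)) * weighted (suc (suc n)) 0 prev) ]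

private
  last : List ℚ → ℚ
  last []           = 0ℚ
  last (x ∷ [])     = x
  last (x ∷ y ∷ ys) = last (y ∷ ys)

B : ℕ → ℚ
B n = last (bernoulliTable n)

private
  partialSum : ℕ → ℕ → ℕ → ℚ
  partialSum r s zero    = B s
  partialSum r s (suc k) = partialSum r s k + ((+ (r C suc k)) / 1) * B (s ℕ.+ suc k)

𝓑 : ℕ → ℕ → ℚ
𝓑 r s = partialSum r s r

{-# OPTIONS --safe #-}
module Submission where

-- Sequences f : ℕ → ℚ stand for exponential generating functions Σ fₙ tⁿ/n!, multiplied by
-- binomial convolution ⋆.  The recurrence defining the Bernoulli numbers says B ⋆ eᵗ = B + t,
-- i.e. 𝓑 r 0 = B r + [r = 1], and hence B ⋆ (eᵗ − 1) = t.  Substituting −t and cancelling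
-- e⁻ᵗ − 1, which has order one, gives (−1)ⁿ Bₙ = Bₙ + [n = 1], so Bₙ = 0 for odd n ≥ 3.
-- Multiplying B ⋆ (eᵗ − 1) = t by 1 + eᵗ + e²ᵗ gives Faulhaber's formula for 0ⁿ + 1ⁿ + 2ⁿ,
-- from which strong induction yields 3Bₙ ≡ 0ⁿ + 1ⁿ + 2ⁿ ≡ −[n even] modulo 3ℤ₍₃₎ for n ≥ 1
-- (von Staudt–Clausen at 3); in particular Bₙ ≠ 0 for even n.  Finally, for r, s ≥ 0 this
-- gives 3𝓑 (r + 1) (s + 1) ≡ −Σ_ν C(r + 1, ν)[s + 1 + ν even] = −2ʳ modulo 3ℤ₍₃₎, and 3 ∤ 2ʳ.

open import Defs
open import Data.Nat using (ℕ; zero; suc; _≤_)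
open import Data.Nat.DivMod using (_%_)
open import Data.Rational using (0ℚ)
open import Data.Product using (_×_; ∃-syntax)
open import Data.Sum using (_⊎_)
open import Relation.Binary.PropositionalEquality using (_≡_)
open import Relation.Nullary using (¬_)
open import Function.Bundles using (_⇔_)

open import Level using (0ℓ)
open import Function using (id; _∘_)
open import Function.Bundles using (mk⇔)
open import Data.Empty using (⊥-elim)
open import Data.Product using (_,_; proj₁; proj₂)
open import Data.Sum using (inj₁; inj₂; [_,_]′)
open import Data.List using (List; []; _∷_; _++_; [_]; length)
open import Data.List.Properties using (length-++)
open import Relation.Binary.PropositionalEquality
  using (refl; sym; trans; cong; cong₂; subst; _≢_; _≗_; module ≡-Reasoning)
open import Relation.Nullary using (yes; no; contradiction)
open import Relation.Nullary.Decidable using (dec⇒maybe; from-yes; from-no)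

open import Data.Nat as ℕ using (_<_; z≤n; s≤s; _^_; _!; NonZero)
import Data.Nat.Properties as ℕ
open import Data.Nat.DivMod using (m/n*n≡m)
open import Data.Nat.Induction using (<-rec)
open import Data.Nat.Divisibility
  using (_∣_; _∤_; _∣?_; _∣0; divides; ∣1⇒≡1; ∣m+n∣m⇒∣n; m∣m*n)
open import Data.Nat.Primality
  using (Prime; prime?; euclidsLemma; ¬prime[1]; prime⇒nonTrivial; prime⇒nonZero)
open import Data.Nat.Coprimality using (Coprime; gcd≡1⇒coprime)
open import Data.Nat.GCD using (gcd-zeroˡ; gcd-zeroʳ)
open import Data.Nat.Combinatorics
  using (_C_; nCk≡nC[n∸k]; nCk+nC[k+1]≡[n+1]C[k+1]; nCn≡1; nC1≡n; k![n∸k]!∣n!)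
open import Data.Nat.Combinatorics.Specification using (nCk≡n!/k![n-k]!)
open import Data.Nat.Tactic.RingSolver using () renaming (solve-∀ to ℕ-solve-∀)
import Data.Integer as ℤ
open import Data.Integer.Tactic.RingSolver using () renaming (solve-∀ to ℤ-solve-∀)
open import Data.Rational as ℚ using (ℚ; 1ℚ; _+_; _*_; -_; _-_; _/_; 1/_; mkℚ; toℚᵘ)
import Data.Rational.Properties as ℚ
import Data.Rational.Unnormalised as ℚᵘ
import Data.Rational.Unnormalised.Properties as ℚᵘ

open import Algebra.Bundles using (Ring; CommutativeMonoid)
open import Algebra.Properties.CommutativeSemigroup
  (CommutativeMonoid.commutativeSemigroup ℚ.+-0-commutativeMonoid)
  using () renaming (interchange to +-interchange)
open import Algebra.Properties.Group ℚ.+-0-group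
  using () renaming (∙-cancelˡ to +-cancelˡ; ⁻¹-involutive to neg-involutive)
open import Algebra.Properties.Semiring.Mult (Ring.semiring ℚ.+-*-ring)
  using (×-homo-+; ×1-homo-*) renaming (_×_ to _×ℚ_)
open import Tactic.RingSolver using (solve-∀)
import Tactic.RingSolver.Core.AlmostCommutativeRing as ACR

ℚ-ring : ACR.AlmostCommutativeRing 0ℓ 0ℓ
ℚ-ring = ACR.fromCommutativeRing ℚ.+-*-commutativeRing (λ x → dec⇒maybe (0ℚ ℚ.≟ x))


ι : ℕ → ℚ
ι n = ℤ.+ n / 1

ι≡mkℚ : ∀ n → ι n ≡ mkℚ (ℤ.+ n) 0 (gcd≡1⇒coprime (gcd-zeroʳ n))
ι≡mkℚ n = ℚ.normalize-coprime _

ι-suc : ∀ n → ι (suc n) ≡ 1ℚ + ι n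
ι-suc n = ℚ.toℚᵘ-injective (begin-equality
  toℚᵘ (ι (suc n))               ≃⟨ ℚ.toℚᵘ-cong (ι≡mkℚ (suc n)) ⟩
  ℚᵘ.mkℚᵘ (ℤ.+ suc n) 0          ≃⟨ ℚᵘ.*≡* (cross-multiplied (ℤ.+ n)) ⟩
  ℚᵘ.1ℚᵘ ℚᵘ.+ ℚᵘ.mkℚᵘ (ℤ.+ n) 0  ≃⟨ ℚᵘ.≃-sym (ℚᵘ.+-congʳ ℚᵘ.1ℚᵘ (ℚ.toℚᵘ-cong (ι≡mkℚ n))) ⟩
  ℚᵘ.1ℚᵘ ℚᵘ.+ toℚᵘ (ι n)         ≃⟨ ℚᵘ.≃-sym (ℚ.toℚᵘ-homo-+ 1ℚ (ι n)) ⟩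
  toℚᵘ (1ℚ + ι n)                ∎)
  where
  open ℚᵘ.≤-Reasoning
  cross-multiplied : ∀ x → (ℤ.+ 1 ℤ.+ x) ℤ.* ℤ.+ 1 ≡ (ℤ.+ 1 ℤ.* ℤ.+ 1 ℤ.+ x ℤ.* ℤ.+ 1) ℤ.* ℤ.+ 1
  cross-multiplied = ℤ-solve-∀

ι≡×1 : ∀ n → ι n ≡ n ×ℚ 1ℚ
ι≡×1 zero    = refl
ι≡×1 (suc n) = trans (ι-suc n) (cong (1ℚ +_) (ι≡×1 n))

ι-homo-+ : ∀ m n → ι (m ℕ.+ n) ≡ ι m + ι n
ι-homo-+ m n = begin
  ι (m ℕ.+ n)         ≡⟨ ι≡×1 (m ℕ.+ n) ⟩
  (m ℕ.+ n) ×ℚ 1ℚ     ≡⟨ ×-homo-+ 1ℚ m n ⟩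
  m ×ℚ 1ℚ + n ×ℚ 1ℚ   ≡⟨ cong₂ _+_ (ι≡×1 m) (ι≡×1 n) ⟨
  ι m + ι n           ∎
  where open ≡-Reasoning

ι-homo-* : ∀ m n → ι (m ℕ.* n) ≡ ι m * ι n
ι-homo-* m n = begin
  ι (m ℕ.* n)             ≡⟨ ι≡×1 (m ℕ.* n) ⟩
  (m ℕ.* n) ×ℚ 1ℚ         ≡⟨ ×1-homo-* m n ⟩
  (m ×ℚ 1ℚ) * (n ×ℚ 1ℚ)   ≡⟨ cong₂ _*_ (ι≡×1 m) (ι≡×1 n) ⟨
  ι m * ι n               ∎
  where open ≡-Reasoning

ι-injective : ∀ {m n} → ι m ≡ ι n → m ≡ n
ι-injective {m} {n} eq with ℚ.mkℚ-injective (trans (sym (ι≡mkℚ m)) (trans eq (ι≡mkℚ n)))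
... | refl , _ = refl

ι-suc-nonZero : ∀ n → ℚ.NonZero (ι (suc n))
ι-suc-nonZero n = ℚ.≢-nonZero λ eq → ℕ.1+n≢0 (ι-injective {suc n} {0} eq)

-- The form of 1/(n + 1) used in Defs, so that the recurrence for B unfolds to it.
1/ι-suc : ℕ → ℚ
1/ι-suc n = ℤ.+ 1 / suc n

ι-suc*1/ι-suc : ∀ n → ι (suc n) * 1/ι-suc n ≡ 1ℚ
ι-suc*1/ι-suc n = trans (cong₂ _*_ (ι≡mkℚ (suc n)) (ℚ.normalize-coprime {1} {n} 1-coprime))
                        (ℚ.*-inverseʳ (mkℚ (ℤ.+ suc n) 0 (gcd≡1⇒coprime (gcd-zeroʳ (suc n)))))
  where
  1-coprime : Coprime 1 (suc n)
  1-coprime = gcd≡1⇒coprime (gcd-zeroˡ (suc n))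

*1/ι-suc*ι-suc : ∀ x n → x * 1/ι-suc n * ι (suc n) ≡ x
*1/ι-suc*ι-suc x n = begin
  x * 1/ι-suc n * ι (suc n)     ≡⟨ ℚ.*-assoc x (1/ι-suc n) (ι (suc n)) ⟩
  x * (1/ι-suc n * ι (suc n))   ≡⟨ cong (x *_) (ℚ.*-comm (1/ι-suc n) (ι (suc n))) ⟩
  x * (ι (suc n) * 1/ι-suc n)   ≡⟨ cong (x *_) (ι-suc*1/ι-suc n) ⟩
  x * 1ℚ                        ≡⟨ ℚ.*-identityʳ x ⟩
  x                             ∎
  where open ≡-Reasoning

*-cancelʳ-nonZero : ∀ r .{{_ : ℚ.NonZero r}} {p q} → p * r ≡ q * r → p ≡ q
*-cancelʳ-nonZero r {p} {q} eq = begin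
  p                 ≡⟨ ℚ.*-identityʳ p ⟨
  p * 1ℚ            ≡⟨ cong (p *_) (ℚ.*-inverseʳ r) ⟨
  p * (r * 1/ r)    ≡⟨ ℚ.*-assoc p r (1/ r) ⟨
  p * r * 1/ r      ≡⟨ cong (_* 1/ r) eq ⟩
  q * r * 1/ r      ≡⟨ ℚ.*-assoc q r (1/ r) ⟩
  q * (r * 1/ r)    ≡⟨ cong (q *_) (ℚ.*-inverseʳ r) ⟩
  q * 1ℚ            ≡⟨ ℚ.*-identityʳ q ⟩
  q                 ∎
  where open ≡-Reasoning

*-cancelˡ-nonZero : ∀ r .{{_ : ℚ.NonZero r}} {p q} → r * p ≡ r * q → p ≡ q
*-cancelˡ-nonZero r {p} {q} eq = *-cancelʳ-nonZero r (trans (ℚ.*-comm p r) (trans eq (ℚ.*-comm r q)))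

C-sym-+ : ∀ a b → (a ℕ.+ b) C a ≡ (b ℕ.+ a) C b
C-sym-+ a b = begin
  (a ℕ.+ b) C a                 ≡⟨ nCk≡nC[n∸k] (ℕ.m≤m+n a b) ⟩
  (a ℕ.+ b) C (a ℕ.+ b ℕ.∸ a)   ≡⟨ cong ((a ℕ.+ b) C_) (ℕ.m+n∸m≡n a b) ⟩
  (a ℕ.+ b) C b                 ≡⟨ cong (_C b) (ℕ.+-comm a b) ⟩
  (b ℕ.+ a) C b                 ∎
  where open ≡-Reasoning

C-pascal-+ : ∀ a b → (suc a ℕ.+ suc b) C suc a ≡ (a ℕ.+ suc b) C a ℕ.+ (suc a ℕ.+ b) C suc a
C-pascal-+ a b = begin
  suc (a ℕ.+ suc b) C suc a                     ≡⟨ nCk+nC[k+1]≡[n+1]C[k+1] (a ℕ.+ suc b) a ⟨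
  (a ℕ.+ suc b) C a ℕ.+ (a ℕ.+ suc b) C suc a   ≡⟨ cong (λ n → (a ℕ.+ suc b) C a ℕ.+ n C suc a) (ℕ.+-suc a b) ⟩
  (a ℕ.+ suc b) C a ℕ.+ (suc a ℕ.+ b) C suc a   ∎
  where open ≡-Reasoning

C-+-0 : ∀ a → (a ℕ.+ 0) C a ≡ 1
C-+-0 a = trans (cong (_C a) (ℕ.+-identityʳ a)) (nCn≡1 a)

C-+-1 : ∀ a → (a ℕ.+ 1) C a ≡ suc a
C-+-1 a = trans (C-sym-+ a 1) (nC1≡n (suc a))

C-suc-self : ∀ n → suc n C n ≡ suc n
C-suc-self n = trans (cong (_C n) (ℕ.+-comm 1 n)) (C-+-1 n)

C*!*!≡! : ∀ a b → ((a ℕ.+ b) C a) ℕ.* (a ! ℕ.* b !) ≡ (a ℕ.+ b) !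
C*!*!≡! a b = begin
  (n C a) ℕ.* (a ! ℕ.* b !)                                 ≡⟨ cong (λ k → (n C a) ℕ.* (a ! ℕ.* k !)) (ℕ.m+n∸m≡n a b) ⟨
  (n C a) ℕ.* (a ! ℕ.* (n ℕ.∸ a) !)                         ≡⟨ cong (ℕ._* (a ! ℕ.* (n ℕ.∸ a) !)) (nCk≡n!/k![n-k]! a≤n) ⟩
  n ! ℕ./ (a ! ℕ.* (n ℕ.∸ a) !) ℕ.* (a ! ℕ.* (n ℕ.∸ a) !)   ≡⟨ m/n*n≡m (k![n∸k]!∣n! a≤n) ⟩
  n !                                                       ∎
  where
  open ≡-Reasoning
  n = a ℕ.+ b
  a≤n = ℕ.m≤m+n a b
  instance
    a![n∸a]!≢0 : NonZero (a ! ℕ.* (n ℕ.∸ a) !)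
    a![n∸a]!≢0 = ℕ._!*_!≢0 a (n ℕ.∸ a)

C-trinomial : ∀ x y z → ((x ℕ.+ y ℕ.+ z) C (x ℕ.+ y)) ℕ.* ((x ℕ.+ y) C x)
                      ≡ ((x ℕ.+ (y ℕ.+ z)) C x) ℕ.* ((y ℕ.+ z) C y)
C-trinomial x y z = ℕ.*-cancelʳ-≡ _ _ (x ! ℕ.* y ! ℕ.* z !) {{x!y!z!≢0}} (begin
  [xy]z ℕ.* xy ℕ.* (x ! ℕ.* y ! ℕ.* z !)         ≡⟨ regroupˡ [xy]z xy (x !) (y !) (z !) ⟩
  [xy]z ℕ.* (xy ℕ.* (x ! ℕ.* y !) ℕ.* z !)       ≡⟨ cong (λ k → [xy]z ℕ.* (k ℕ.* z !)) (C*!*!≡! x y) ⟩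
  [xy]z ℕ.* ((x ℕ.+ y) ! ℕ.* z !)                ≡⟨ C*!*!≡! (x ℕ.+ y) z ⟩
  (x ℕ.+ y ℕ.+ z) !                              ≡⟨ cong _! (ℕ.+-assoc x y z) ⟩
  (x ℕ.+ (y ℕ.+ z)) !                            ≡⟨ C*!*!≡! x (y ℕ.+ z) ⟨
  x[yz] ℕ.* (x ! ℕ.* (y ℕ.+ z) !)                ≡⟨ cong (λ k → x[yz] ℕ.* (x ! ℕ.* k)) (C*!*!≡! y z) ⟨
  x[yz] ℕ.* (x ! ℕ.* (yz ℕ.* (y ! ℕ.* z !)))     ≡⟨ regroupʳ x[yz] yz (x !) (y !) (z !) ⟩
  x[yz] ℕ.* yz ℕ.* (x ! ℕ.* y ! ℕ.* z !)         ∎)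
  where
  open ≡-Reasoning
  [xy]z = (x ℕ.+ y ℕ.+ z) C (x ℕ.+ y)
  xy    = (x ℕ.+ y) C x
  x[yz] = (x ℕ.+ (y ℕ.+ z)) C x
  yz    = (y ℕ.+ z) C y
  x!y!z!≢0 : NonZero (x ! ℕ.* y ! ℕ.* z !)
  x!y!z!≢0 = ℕ.m*n≢0 _ _ {{ℕ._!*_!≢0 x y}} {{ℕ._!≢0 z}}
  regroupˡ : ∀ c d u v w → c ℕ.* d ℕ.* (u ℕ.* v ℕ.* w) ≡ c ℕ.* (d ℕ.* (u ℕ.* v) ℕ.* w)
  regroupˡ = ℕ-solve-∀
  regroupʳ : ∀ c d u v w → c ℕ.* (u ℕ.* (d ℕ.* (v ℕ.* w))) ≡ c ℕ.* d ℕ.* (u ℕ.* v ℕ.* w)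
  regroupʳ = ℕ-solve-∀

C-absorption : ∀ a b → suc b ℕ.* ((a ℕ.+ suc b) C a) ≡ (a ℕ.+ suc b) ℕ.* ((a ℕ.+ b) C a)
C-absorption a b = ℕ.*-cancelʳ-≡ _ _ (a ! ℕ.* b !) {{ℕ._!*_!≢0 a b}} (begin
  suc b ℕ.* ((a ℕ.+ suc b) C a) ℕ.* (a ! ℕ.* b !)         ≡⟨ regroup (suc b) ((a ℕ.+ suc b) C a) (a !) (b !) ⟩
  ((a ℕ.+ suc b) C a) ℕ.* (a ! ℕ.* suc b !)               ≡⟨ C*!*!≡! a (suc b) ⟩
  (a ℕ.+ suc b) !                                         ≡⟨ cong _! (ℕ.+-suc a b) ⟩
  suc (a ℕ.+ b) ℕ.* (a ℕ.+ b) !                           ≡⟨ cong (λ n → n ℕ.* (a ℕ.+ b) !) (ℕ.+-suc a b) ⟨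
  (a ℕ.+ suc b) ℕ.* (a ℕ.+ b) !                           ≡⟨ cong ((a ℕ.+ suc b) ℕ.*_) (C*!*!≡! a b) ⟨
  (a ℕ.+ suc b) ℕ.* (((a ℕ.+ b) C a) ℕ.* (a ! ℕ.* b !))   ≡⟨ ℕ.*-assoc (a ℕ.+ suc b) ((a ℕ.+ b) C a) _ ⟨
  (a ℕ.+ suc b) ℕ.* ((a ℕ.+ b) C a) ℕ.* (a ! ℕ.* b !)     ∎)
  where
  open ≡-Reasoning
  regroup : ∀ s c u v → s ℕ.* c ℕ.* (u ℕ.* v) ≡ c ℕ.* (u ℕ.* (s ℕ.* v))
  regroup = ℕ-solve-∀

binom : ℕ → ℕ → ℚ
binom a b = ι ((a ℕ.+ b) C a)

binom-sym : ∀ a b → binom a b ≡ binom b a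
binom-sym a b = cong ι (C-sym-+ a b)

binom-zeroʳ : ∀ a → binom a 0 ≡ 1ℚ
binom-zeroʳ a = cong ι (C-+-0 a)

binom-oneʳ : ∀ a → binom a 1 ≡ ι (suc a)
binom-oneʳ a = cong ι (C-+-1 a)

binom-pascal : ∀ a b → binom (suc a) (suc b) ≡ binom a (suc b) + binom (suc a) b
binom-pascal a b = trans (cong ι (C-pascal-+ a b))
                         (ι-homo-+ ((a ℕ.+ suc b) C a) ((suc a ℕ.+ b) C suc a))

binom-trinomial : ∀ x y z → binom (x ℕ.+ y) z * binom x y ≡ binom x (y ℕ.+ z) * binom y z
binom-trinomial x y z = begin
  binom (x ℕ.+ y) z * binom x y                           ≡⟨ ι-homo-* ((x ℕ.+ y ℕ.+ z) C (x ℕ.+ y)) ((x ℕ.+ y) C x) ⟨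
  ι (((x ℕ.+ y ℕ.+ z) C (x ℕ.+ y)) ℕ.* ((x ℕ.+ y) C x))   ≡⟨ cong ι (C-trinomial x y z) ⟩
  ι (((x ℕ.+ (y ℕ.+ z)) C x) ℕ.* ((y ℕ.+ z) C y))         ≡⟨ ι-homo-* ((x ℕ.+ (y ℕ.+ z)) C x) ((y ℕ.+ z) C y) ⟩
  binom x (y ℕ.+ z) * binom y z                           ∎
  where open ≡-Reasoning

binom-absorption : ∀ a b → ι (suc b) * binom a (suc b) ≡ ι (a ℕ.+ suc b) * binom a b
binom-absorption a b = begin
  ι (suc b) * binom a (suc b)                   ≡⟨ ι-homo-* (suc b) ((a ℕ.+ suc b) C a) ⟨
  ι (suc b ℕ.* ((a ℕ.+ suc b) C a))             ≡⟨ cong ι (C-absorption a b) ⟩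
  ι ((a ℕ.+ suc b) ℕ.* ((a ℕ.+ b) C a))         ≡⟨ ι-homo-* (a ℕ.+ suc b) ((a ℕ.+ b) C a) ⟩
  ι (a ℕ.+ suc b) * binom a b                   ∎
  where open ≡-Reasoning

-- Sums over antidiagonals

Δ : ℕ → (ℕ → ℕ → ℚ) → ℚ
Δ zero    F = F 0 0
Δ (suc n) F = Δ n (λ a b → F a (suc b)) + F (suc n) 0

Δ-cong : ∀ n {F G : ℕ → ℕ → ℚ} → (∀ a b → a ℕ.+ b ≡ n → F a b ≡ G a b) → Δ n F ≡ Δ n G
Δ-cong zero    F≡G = F≡G 0 0 refl
Δ-cong (suc n) F≡G = cong₂ _+_
  (Δ-cong n λ a b a+b≡n → F≡G a (suc b) (trans (ℕ.+-suc a b) (cong suc a+b≡n)))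
  (F≡G (suc n) 0 (ℕ.+-identityʳ (suc n)))

Δ-closed : (P : ℚ → Set) → (∀ {x y} → P x → P y → P (x + y)) →
           ∀ n F → (∀ a b → a ℕ.+ b ≡ n → P (F a b)) → P (Δ n F)
Δ-closed P P-+ zero    F PF = PF 0 0 refl
Δ-closed P P-+ (suc n) F PF = P-+
  (Δ-closed P P-+ n _ λ a b a+b≡n → PF a (suc b) (trans (ℕ.+-suc a b) (cong suc a+b≡n)))
  (PF (suc n) 0 (ℕ.+-identityʳ (suc n)))

Δ-zero : ∀ n F → (∀ a b → a ℕ.+ b ≡ n → F a b ≡ 0ℚ) → Δ n F ≡ 0ℚ
Δ-zero = Δ-closed (_≡ 0ℚ) (cong₂ _+_)

Δ-distrib-+ : ∀ n F G → Δ n (λ a b → F a b + G a b) ≡ Δ n F + Δ n G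
Δ-distrib-+ zero    F G = refl
Δ-distrib-+ (suc n) F G = trans
  (cong (_+ (F (suc n) 0 + G (suc n) 0)) (Δ-distrib-+ n (λ a b → F a (suc b)) (λ a b → G a (suc b))))
  (+-interchange (Δ n (λ a b → F a (suc b))) (Δ n (λ a b → G a (suc b))) (F (suc n) 0) (G (suc n) 0))

Δ-neg : ∀ n F → Δ n (λ a b → - F a b) ≡ - Δ n F
Δ-neg zero    F = refl
Δ-neg (suc n) F = trans (cong (_+ - F (suc n) 0) (Δ-neg n (λ a b → F a (suc b))))
                        (sym (ℚ.neg-distrib-+ (Δ n (λ a b → F a (suc b))) (F (suc n) 0)))

Δ-*ˡ : ∀ n k F → Δ n (λ a b → k * F a b) ≡ k * Δ n F
Δ-*ˡ zero    k F = refl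
Δ-*ˡ (suc n) k F = trans (cong (_+ k * F (suc n) 0) (Δ-*ˡ n k (λ a b → F a (suc b))))
                         (sym (ℚ.*-distribˡ-+ k (Δ n (λ a b → F a (suc b))) (F (suc n) 0)))

Δ-head : ∀ n F → Δ (suc n) F ≡ F 0 (suc n) + Δ n (λ a b → F (suc a) b)
Δ-head zero    F = refl
Δ-head (suc n) F = trans (cong (_+ F (suc (suc n)) 0) (Δ-head n (λ a b → F a (suc b))))
                         (ℚ.+-assoc (F 0 (suc (suc n))) (Δ n (λ a b → F (suc a) (suc b))) (F (suc (suc n)) 0))

Δ-swap : ∀ n F → Δ n (λ a b → F b a) ≡ Δ n F
Δ-swap zero    F = refl
Δ-swap (suc n) F = begin
  Δ n (λ a b → F (suc b) a) + F 0 (suc n)   ≡⟨ cong (_+ F 0 (suc n)) (Δ-swap n (λ a b → F (suc a) b)) ⟩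
  Δ n (λ a b → F (suc a) b) + F 0 (suc n)   ≡⟨ ℚ.+-comm _ (F 0 (suc n)) ⟩
  F 0 (suc n) + Δ n (λ a b → F (suc a) b)   ≡⟨ Δ-head n F ⟨
  Δ (suc n) F                               ∎
  where open ≡-Reasoning

Δ-assoc : ∀ n (F : ℕ → ℕ → ℕ → ℚ) →
          Δ n (λ a b → Δ a (λ x y → F x y b)) ≡ Δ n (λ a b → Δ b (λ y z → F a y z))
Δ-assoc zero    F = refl
Δ-assoc (suc n) F = begin
  Δ n (λ a b → Δ a (λ x y → F x y (suc b))) + Δ (suc n) (λ x y → F x y 0)
    ≡⟨ cong (_+ Δ (suc n) (λ x y → F x y 0)) (Δ-assoc n (λ x y z → F x y (suc z))) ⟩
  Δ n (λ a b → Δ b (λ y z → F a y (suc z))) + (Δ n (λ a b → F a (suc b) 0) + F (suc n) 0 0)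
    ≡⟨ ℚ.+-assoc (Δ n (λ a b → Δ b (λ y z → F a y (suc z)))) _ _ ⟨
  Δ n (λ a b → Δ b (λ y z → F a y (suc z))) + Δ n (λ a b → F a (suc b) 0) + F (suc n) 0 0
    ≡⟨ cong (_+ F (suc n) 0 0) (Δ-distrib-+ n (λ a b → Δ b (λ y z → F a y (suc z))) (λ a b → F a (suc b) 0)) ⟨
  Δ n (λ a b → Δ (suc b) (λ y z → F a y z)) + F (suc n) 0 0 ∎
  where open ≡-Reasoning

-- Exponential generating functions

Seq : Set
Seq = ℕ → ℚ

infixl 7 _⋆_
_⋆_ : Seq → Seq → Seq
(f ⋆ g) n = Δ n (λ a b → binom a b * (f a * g b))

infixl 6 _⊕_ _⊖_
_⊕_ : Seq → Seq → Seq
(f ⊕ g) n = f n + g n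

_⊖_ : Seq → Seq → Seq
(f ⊖ g) n = f n - g n

infixr 8 _·_
_·_ : ℚ → Seq → Seq
(k · f) n = k * f n

-- Differentiation of exponential generating functions.
shift : Seq → Seq
shift f n = f (suc n)

pow : ℚ → Seq
pow x zero    = 1ℚ
pow x (suc n) = x * pow x n

X : Seq
X zero          = 0ℚ
X (suc zero)    = 1ℚ
X (suc (suc n)) = 0ℚ

𝟘 : Seq
𝟘 n = 0ℚ

⋆-congˡ : ∀ f {g g′} → g ≗ g′ → f ⋆ g ≗ f ⋆ g′
⋆-congˡ f g≗g′ n = Δ-cong n λ a b _ → cong (λ x → binom a b * (f a * x)) (g≗g′ b)

⋆-congʳ : ∀ g {f f′} → f ≗ f′ → f ⋆ g ≗ f′ ⋆ g
⋆-congʳ g f≗f′ n = Δ-cong n λ a b _ → cong (λ x → binom a b * (x * g b)) (f≗f′ a)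

⋆-comm : ∀ f g → f ⋆ g ≗ g ⋆ f
⋆-comm f g n = begin
  Δ n (λ a b → binom a b * (f a * g b))   ≡⟨ Δ-swap n (λ a b → binom a b * (f a * g b)) ⟨
  Δ n (λ a b → binom b a * (f b * g a))   ≡⟨ Δ-cong n (λ a b _ → cong₂ _*_ (binom-sym b a) (ℚ.*-comm (f b) (g a))) ⟩
  Δ n (λ a b → binom a b * (g a * f b))   ∎
  where open ≡-Reasoning

⋆-distribˡ-⊕ : ∀ f g h → f ⋆ (g ⊕ h) ≗ f ⋆ g ⊕ f ⋆ h
⋆-distribˡ-⊕ f g h n = trans
  (Δ-cong n λ a b _ → distrib (binom a b) (f a) (g b) (h b))
  (Δ-distrib-+ n (λ a b → binom a b * (f a * g b)) (λ a b → binom a b * (f a * h b)))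
  where
  distrib : ∀ c x y z → c * (x * (y + z)) ≡ c * (x * y) + c * (x * z)
  distrib = solve-∀ ℚ-ring

⋆-distribˡ-⊖ : ∀ f g h → f ⋆ (g ⊖ h) ≗ f ⋆ g ⊖ f ⋆ h
⋆-distribˡ-⊖ f g h n = begin
  (f ⋆ (g ⊖ h)) n
    ≡⟨ Δ-cong n (λ a b _ → distrib (binom a b) (f a) (g b) (h b)) ⟩
  Δ n (λ a b → binom a b * (f a * g b) + - (binom a b * (f a * h b)))
    ≡⟨ Δ-distrib-+ n (λ a b → binom a b * (f a * g b)) _ ⟩
  (f ⋆ g) n + Δ n (λ a b → - (binom a b * (f a * h b)))
    ≡⟨ cong ((f ⋆ g) n +_) (Δ-neg n (λ a b → binom a b * (f a * h b))) ⟩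
  (f ⋆ g) n - (f ⋆ h) n ∎
  where
  open ≡-Reasoning
  distrib : ∀ c x y z → c * (x * (y - z)) ≡ c * (x * y) + - (c * (x * z))
  distrib = solve-∀ ℚ-ring

⋆-distribʳ-⊕ : ∀ f g h → (f ⊕ g) ⋆ h ≗ f ⋆ h ⊕ g ⋆ h
⋆-distribʳ-⊕ f g h n = begin
  ((f ⊕ g) ⋆ h) n           ≡⟨ ⋆-comm (f ⊕ g) h n ⟩
  (h ⋆ (f ⊕ g)) n           ≡⟨ ⋆-distribˡ-⊕ h f g n ⟩
  (h ⋆ f) n + (h ⋆ g) n     ≡⟨ cong₂ _+_ (⋆-comm h f n) (⋆-comm h g n) ⟩
  (f ⋆ h) n + (g ⋆ h) n     ∎
  where open ≡-Reasoning

⋆-distribʳ-⊖ : ∀ f g h → (f ⊖ g) ⋆ h ≗ f ⋆ h ⊖ g ⋆ h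
⋆-distribʳ-⊖ f g h n = begin
  ((f ⊖ g) ⋆ h) n           ≡⟨ ⋆-comm (f ⊖ g) h n ⟩
  (h ⋆ (f ⊖ g)) n           ≡⟨ ⋆-distribˡ-⊖ h f g n ⟩
  (h ⋆ f) n - (h ⋆ g) n     ≡⟨ cong₂ _-_ (⋆-comm h f n) (⋆-comm h g n) ⟩
  (f ⋆ h) n - (g ⋆ h) n     ∎
  where open ≡-Reasoning

⋆-·ˡ : ∀ k f g → (k · f) ⋆ g ≗ k · (f ⋆ g)
⋆-·ˡ k f g n = trans
  (Δ-cong n λ a b _ → pull (binom a b) k (f a) (g b))
  (Δ-*ˡ n k (λ a b → binom a b * (f a * g b)))
  where
  pull : ∀ c k x y → c * ((k * x) * y) ≡ k * (c * (x * y))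
  pull = solve-∀ ℚ-ring

⋆-·ʳ : ∀ k f g → f ⋆ (k · g) ≗ k · (f ⋆ g)
⋆-·ʳ k f g n = begin
  (f ⋆ (k · g)) n     ≡⟨ ⋆-comm f (k · g) n ⟩
  ((k · g) ⋆ f) n     ≡⟨ ⋆-·ˡ k g f n ⟩
  k * (g ⋆ f) n       ≡⟨ cong (k *_) (⋆-comm g f n) ⟩
  k * (f ⋆ g) n       ∎
  where open ≡-Reasoning

⋆-zeroʳ : ∀ f → f ⋆ 𝟘 ≗ 𝟘
⋆-zeroʳ f n = Δ-zero n _ λ a b _ →
  trans (cong (binom a b *_) (ℚ.*-zeroʳ (f a))) (ℚ.*-zeroʳ (binom a b))

⋆-assoc : ∀ f g h → (f ⋆ g) ⋆ h ≗ f ⋆ (g ⋆ h)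
⋆-assoc f g h n = begin
  ((f ⋆ g) ⋆ h) n                          ≡⟨ Δ-cong n (λ a b _ → expandˡ a b) ⟩
  Δ n (λ a b → Δ a (λ x y → T x y b))      ≡⟨ Δ-assoc n T ⟩
  Δ n (λ a b → Δ b (λ y z → T a y z))      ≡⟨ Δ-cong n (λ a b _ → expandʳ a b) ⟨
  (f ⋆ (g ⋆ h)) n                          ∎
  where
  open ≡-Reasoning
  T : ℕ → ℕ → ℕ → ℚ
  T x y z = binom x (y ℕ.+ z) * binom y z * (f x * g y * h z)

  swap : ∀ c d e → c * (d * e) ≡ c * e * d
  swap = solve-∀ ℚ-ring
  regroupˡ : ∀ c e d x y → c * e * (d * (x * y)) ≡ c * d * (x * y * e)
  regroupˡ = solve-∀ ℚ-ring
  regroupʳ : ∀ c x d y z → c * x * (d * (y * z)) ≡ c * d * (x * y * z)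
  regroupʳ = solve-∀ ℚ-ring

  expandˡ : ∀ a b → binom a b * ((f ⋆ g) a * h b) ≡ Δ a (λ x y → T x y b)
  expandˡ a b = begin
    binom a b * ((f ⋆ g) a * h b)                                  ≡⟨ swap (binom a b) ((f ⋆ g) a) (h b) ⟩
    binom a b * h b * (f ⋆ g) a                                    ≡⟨ Δ-*ˡ a (binom a b * h b) (λ x y → binom x y * (f x * g y)) ⟨
    Δ a (λ x y → binom a b * h b * (binom x y * (f x * g y)))      ≡⟨ Δ-cong a term ⟩
    Δ a (λ x y → T x y b)                                          ∎
    where
    term : ∀ x y → x ℕ.+ y ≡ a → binom a b * h b * (binom x y * (f x * g y)) ≡ T x y b
    term x y refl = trans (regroupˡ (binom (x ℕ.+ y) b) (h b) (binom x y) (f x) (g y))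
                          (cong (_* (f x * g y * h b)) (binom-trinomial x y b))

  expandʳ : ∀ a b → binom a b * (f a * (g ⋆ h) b) ≡ Δ b (λ y z → T a y z)
  expandʳ a b = begin
    binom a b * (f a * (g ⋆ h) b)                                  ≡⟨ ℚ.*-assoc (binom a b) (f a) ((g ⋆ h) b) ⟨
    binom a b * f a * (g ⋆ h) b                                    ≡⟨ Δ-*ˡ b (binom a b * f a) (λ y z → binom y z * (g y * h z)) ⟨
    Δ b (λ y z → binom a b * f a * (binom y z * (g y * h z)))      ≡⟨ Δ-cong b term ⟩
    Δ b (λ y z → T a y z)                                          ∎
    where
    term : ∀ y z → y ℕ.+ z ≡ b → binom a b * f a * (binom y z * (g y * h z)) ≡ T a y z
    term y z refl = regroupʳ (binom a (y ℕ.+ z)) (f a) (binom y z) (g y) (h z)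

⋆-identityʳ : ∀ f → f ⋆ pow 0ℚ ≗ f
⋆-identityʳ f zero    = trans (ℚ.*-identityˡ (f 0 * 1ℚ)) (ℚ.*-identityʳ (f 0))
⋆-identityʳ f (suc n) = begin
  Δ n (λ a b → binom a (suc b) * (f a * (0ℚ * pow 0ℚ b))) + binom (suc n) 0 * (f (suc n) * 1ℚ)
    ≡⟨ cong₂ _+_ (Δ-zero n _ λ a b _ → vanish (binom a (suc b)) (f a) (pow 0ℚ b))
                 (cong (_* (f (suc n) * 1ℚ)) (binom-zeroʳ (suc n))) ⟩
  0ℚ + 1ℚ * (f (suc n) * 1ℚ)
    ≡⟨ simplify (f (suc n)) ⟩
  f (suc n) ∎
  where
  open ≡-Reasoning
  vanish : ∀ c x y → c * (x * (0ℚ * y)) ≡ 0ℚ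
  vanish = solve-∀ ℚ-ring
  simplify : ∀ x → 0ℚ + 1ℚ * (x * 1ℚ) ≡ x
  simplify = solve-∀ ℚ-ring

shift-⋆ : ∀ f g → shift (f ⋆ g) ≗ shift f ⋆ g ⊕ f ⋆ shift g
shift-⋆ f g n = begin
  Δ (suc n) H                               ≡⟨ Δ-cong (suc n) split ⟩
  Δ (suc n) (λ a b → L a b + R a b)         ≡⟨ Δ-distrib-+ (suc n) L R ⟩
  Δ (suc n) L + Δ (suc n) R                 ≡⟨ cong (_+ Δ (suc n) R) (Δ-head n L) ⟩
  (0ℚ + Δ n (λ a b → L (suc a) b)) + (Δ n (λ a b → R a (suc b)) + 0ℚ)
    ≡⟨ cong₂ _+_ (ℚ.+-identityˡ (Δ n (λ a b → L (suc a) b))) (ℚ.+-identityʳ (Δ n (λ a b → R a (suc b)))) ⟩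
  (shift f ⋆ g) n + (f ⋆ shift g) n         ∎
  where
  open ≡-Reasoning
  H L R : ℕ → ℕ → ℚ
  H a b = binom a b * (f a * g b)
  L zero    b = 0ℚ
  L (suc a) b = binom a b * (f (suc a) * g b)
  R a zero    = 0ℚ
  R a (suc b) = binom a b * (f a * g (suc b))
  split : ∀ a b → a ℕ.+ b ≡ suc n → H a b ≡ L a b + R a b
  split zero    (suc b) _ = sym (ℚ.+-identityˡ _)
  split (suc a) zero    _ = trans (cong (_* (f (suc a) * g 0)) (trans (binom-zeroʳ (suc a)) (sym (binom-zeroʳ a))))
                                  (sym (ℚ.+-identityʳ _))
  split (suc a) (suc b) _ = trans (cong (_* (f (suc a) * g (suc b))) (binom-pascal a b))
                                  (ℚ.*-distribʳ-+ (f (suc a) * g (suc b)) (binom a (suc b)) (binom (suc a) b))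

pow-⋆ : ∀ x y → pow x ⋆ pow y ≗ pow (x + y)
pow-⋆ x y zero    = refl
pow-⋆ x y (suc n) = begin
  (pow x ⋆ pow y) (suc n)                               ≡⟨ shift-⋆ (pow x) (pow y) n ⟩
  (x · pow x ⋆ pow y) n + (pow x ⋆ y · pow y) n         ≡⟨ cong₂ _+_ (⋆-·ˡ x (pow x) (pow y) n)
                                                                     (⋆-·ʳ y (pow x) (pow y) n) ⟩
  x * (pow x ⋆ pow y) n + y * (pow x ⋆ pow y) n         ≡⟨ ℚ.*-distribʳ-+ ((pow x ⋆ pow y) n) x y ⟨
  (x + y) * (pow x ⋆ pow y) n                           ≡⟨ cong ((x + y) *_) (pow-⋆ x y n) ⟩
  (x + y) * pow (x + y) n                               ∎
  where open ≡-Reasoning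

⋆-X : ∀ f m → (f ⋆ X) (suc m) ≡ ι (suc m) * f m
⋆-X f m = trans (cong₂ _+_ (X-terms m) (vanish (binom (suc m) 0) (f (suc m)))) (ℚ.+-identityʳ _)
  where
  vanish : ∀ c x → c * (x * 0ℚ) ≡ 0ℚ
  vanish = solve-∀ ℚ-ring
  X-terms : ∀ m → Δ m (λ a b → binom a (suc b) * (f a * X (suc b))) ≡ ι (suc m) * f m
  X-terms zero    = cong (1ℚ *_) (ℚ.*-identityʳ (f 0))
  X-terms (suc m) = begin
    Δ m (λ a b → binom a (suc (suc b)) * (f a * 0ℚ)) + binom (suc m) 1 * (f (suc m) * 1ℚ)
      ≡⟨ cong₂ _+_ (Δ-zero m _ λ a b _ → vanish (binom a (suc (suc b))) (f a))
                   (cong₂ _*_ (binom-oneʳ (suc m)) (ℚ.*-identityʳ (f (suc m)))) ⟩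
    0ℚ + ι (suc (suc m)) * f (suc m)
      ≡⟨ ℚ.+-identityˡ _ ⟩
    ι (suc (suc m)) * f (suc m) ∎
    where open ≡-Reasoning

-- The coefficient of tⁿ⁺¹ in f ⋆ w is (n + 1) (w 1) (f n) plus terms in f 0, …, f (n − 1).
⋆-cancelʳ : ∀ w → w 0 ≡ 0ℚ → .{{_ : ℚ.NonZero (w 1)}} → ∀ {f g} → f ⋆ w ≗ g ⋆ w → f ≗ g
⋆-cancelʳ w w0≡0 {f} {g} f⋆w≗g⋆w = <-rec (λ n → f n ≡ g n) step
  where
  open ≡-Reasoning
  lower : Seq → ℕ → ℚ
  lower h zero    = 0ℚ
  lower h (suc m) = Δ m (λ a b → binom a (suc (suc b)) * (h a * w (suc (suc b))))

  split : ∀ h n → (h ⋆ w) (suc n) ≡ lower h n + ι (suc n) * (h n * w 1)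
  split h n = begin
    Δ n (λ a b → binom a (suc b) * (h a * w (suc b))) + binom (suc n) 0 * (h (suc n) * w 0)
      ≡⟨ cong (λ z → Δ n (λ a b → binom a (suc b) * (h a * w (suc b))) + binom (suc n) 0 * (h (suc n) * z)) w0≡0 ⟩
    Δ n (λ a b → binom a (suc b) * (h a * w (suc b))) + binom (suc n) 0 * (h (suc n) * 0ℚ)
      ≡⟨ drop (Δ n (λ a b → binom a (suc b) * (h a * w (suc b)))) (binom (suc n) 0) (h (suc n)) ⟩
    Δ n (λ a b → binom a (suc b) * (h a * w (suc b)))
      ≡⟨ upper n ⟩
    lower h n + ι (suc n) * (h n * w 1) ∎
    where
    drop : ∀ x c y → x + c * (y * 0ℚ) ≡ x
    drop = solve-∀ ℚ-ring
    upper : ∀ n → Δ n (λ a b → binom a (suc b) * (h a * w (suc b))) ≡ lower h n + ι (suc n) * (h n * w 1)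
    upper zero    = sym (ℚ.+-identityˡ _)
    upper (suc m) = cong (lower h (suc m) +_) (cong (_* (h (suc m) * w 1)) (binom-oneʳ (suc m)))

  step : ∀ n → (∀ {a} → a < n → f a ≡ g a) → f n ≡ g n
  step n ih = *-cancelʳ-nonZero (w 1) (*-cancelˡ-nonZero (ι (suc n)) {{ι-suc-nonZero n}}
    (+-cancelˡ (lower f n) _ _ (begin
      lower f n + ι (suc n) * (f n * w 1)    ≡⟨ split f n ⟨
      (f ⋆ w) (suc n)                        ≡⟨ f⋆w≗g⋆w (suc n) ⟩
      (g ⋆ w) (suc n)                        ≡⟨ split g n ⟩
      lower g n + ι (suc n) * (g n * w 1)    ≡⟨ cong (_+ ι (suc n) * (g n * w 1)) (lower-cong n ih) ⟨
      lower f n + ι (suc n) * (g n * w 1)    ∎)))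
    where
    lower-cong : ∀ n → (∀ {a} → a < n → f a ≡ g a) → lower f n ≡ lower g n
    lower-cong zero    ih = refl
    lower-cong (suc m) ih = Δ-cong m λ a b a+b≡m →
      cong (λ x → binom a (suc (suc b)) * (x * w (suc (suc b)))) (ih (s≤s (subst (a ≤_) a+b≡m (ℕ.m≤m+n a b))))

pow-1 : ∀ n → pow 1ℚ n ≡ 1ℚ
pow-1 zero    = refl
pow-1 (suc n) = trans (ℚ.*-identityˡ (pow 1ℚ n)) (pow-1 n)

pow-ι : ∀ k n → pow (ι k) n ≡ ι (k ^ n)
pow-ι k zero    = refl
pow-ι k (suc n) = trans (cong (ι k *_) (pow-ι k n)) (sym (ι-homo-* k (k ^ n)))

⋆-pow-1 : ∀ f n → (f ⋆ pow 1ℚ) n ≡ Δ n (λ a _ → ι (n C a) * f a)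
⋆-pow-1 f n = Δ-cong n λ a b a+b≡n →
  cong₂ (λ m x → ι (m C a) * x) a+b≡n (trans (cong (f a *_) (pow-1 b)) (ℚ.*-identityʳ (f a)))

-- Defs keeps the helpers behind B and 𝓑 private.  Each mutual block below recovers one of
-- them as the solution of a unification problem (made a pattern problem by the `with`
-- abstractions), so that it computes exactly as in Defs.
mutual
  lastᴮ : List ℚ → ℚ
  lastᴮ = _

  B≡lastᴮ : ∀ n → B n ≡ lastᴮ (bernoulliTable n)
  B≡lastᴮ n with bernoulliTable n
  ... | xs = refl

mutual
  weightedᴮ : ℕ → List ℚ → ℚ
  weightedᴮ = _

  bernoulliTable-suc-unfold : ∀ n → bernoulliTable (suc n) ≡
    bernoulliTable n ++ [ - (1/ι-suc (suc n) * weightedᴮ n (bernoulliTable n)) ]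
  bernoulliTable-suc-unfold n with bernoulliTable n
  ... | xs = refl

mutual
  weighted : ℕ → ℕ → List ℚ → ℚ
  weighted = _

  weightedᴮ≡weighted : ∀ n xs → weightedᴮ n xs ≡ weighted (suc (suc n)) 0 xs
  weightedᴮ≡weighted n xs with suc (suc n) | 0
  ... | m | i = refl

mutual
  partialSum : ℕ → ℕ → ℕ → ℚ
  partialSum = _

  𝓑-suc≡partialSum : ∀ r s →
    𝓑 (suc r) s ≡ partialSum (suc r) s r + (ℤ.+ (suc r C suc r) / 1) * B (s ℕ.+ suc r)
  𝓑-suc≡partialSum r s with suc r | _+_
  ... | _ | _ = refl

lastᴮ-snoc : ∀ xs x → lastᴮ (xs ++ [ x ]) ≡ x
lastᴮ-snoc []           x = refl
lastᴮ-snoc (_ ∷ [])     x = refl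
lastᴮ-snoc (_ ∷ y ∷ ys) x = lastᴮ-snoc (y ∷ ys) x

B-suc : ∀ n → B (suc n) ≡ - (1/ι-suc (suc n) * weighted (suc (suc n)) 0 (bernoulliTable n))
B-suc n = lastᴮ-snoc (bernoulliTable n) _

bernoulliTable-suc : ∀ n → bernoulliTable (suc n) ≡ bernoulliTable n ++ [ B (suc n) ]
bernoulliTable-suc n = cong (λ x → bernoulliTable n ++ [ x ]) (sym (B-suc n))

length-bernoulliTable : ∀ n → length (bernoulliTable n) ≡ suc n
length-bernoulliTable zero    = refl
length-bernoulliTable (suc n) = begin
  length (bernoulliTable (suc n))                  ≡⟨ cong length (bernoulliTable-suc n) ⟩
  length (bernoulliTable n ++ [ B (suc n) ])       ≡⟨ length-++ (bernoulliTable n) ⟩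
  length (bernoulliTable n) ℕ.+ 1                  ≡⟨ cong (ℕ._+ 1) (length-bernoulliTable n) ⟩
  suc n ℕ.+ 1                                      ≡⟨ ℕ.+-comm (suc n) 1 ⟩
  suc (suc n)                                      ∎
  where open ≡-Reasoning

weighted-snoc : ∀ m i xs x → weighted m i (xs ++ [ x ]) ≡ weighted m i xs + ι (m C (i ℕ.+ length xs)) * x
weighted-snoc m i []       x = begin
  ι (m C i) * x + 0ℚ              ≡⟨ ℚ.+-identityʳ _ ⟩
  ι (m C i) * x                   ≡⟨ cong (λ k → ι (m C k) * x) (ℕ.+-identityʳ i) ⟨
  ι (m C (i ℕ.+ 0)) * x           ≡⟨ ℚ.+-identityˡ _ ⟨
  0ℚ + ι (m C (i ℕ.+ 0)) * x      ∎
  where open ≡-Reasoning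
weighted-snoc m i (y ∷ xs) x = begin
  ι (m C i) * y + weighted m (suc i) (xs ++ [ x ])
    ≡⟨ cong (ι (m C i) * y +_) (weighted-snoc m (suc i) xs x) ⟩
  ι (m C i) * y + (weighted m (suc i) xs + ι (m C (suc i ℕ.+ length xs)) * x)
    ≡⟨ ℚ.+-assoc (ι (m C i) * y) _ _ ⟨
  ι (m C i) * y + weighted m (suc i) xs + ι (m C (suc i ℕ.+ length xs)) * x
    ≡⟨ cong (λ k → ι (m C i) * y + weighted m (suc i) xs + ι (m C k) * x) (ℕ.+-suc i (length xs)) ⟨
  ι (m C i) * y + weighted m (suc i) xs + ι (m C (i ℕ.+ suc (length xs))) * x ∎
  where open ≡-Reasoning

weighted-bernoulliTable : ∀ m n → weighted m 0 (bernoulliTable n) ≡ Δ n (λ a _ → ι (m C a) * B a)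
weighted-bernoulliTable m zero    = ℚ.+-identityʳ _
weighted-bernoulliTable m (suc n) = begin
  weighted m 0 (bernoulliTable (suc n))
    ≡⟨ cong (weighted m 0) (bernoulliTable-suc n) ⟩
  weighted m 0 (bernoulliTable n ++ [ B (suc n) ])
    ≡⟨ weighted-snoc m 0 (bernoulliTable n) (B (suc n)) ⟩
  weighted m 0 (bernoulliTable n) + ι (m C length (bernoulliTable n)) * B (suc n)
    ≡⟨ cong₂ (λ x k → x + ι (m C k) * B (suc n)) (weighted-bernoulliTable m n) (length-bernoulliTable n) ⟩
  Δ (suc n) (λ a _ → ι (m C a) * B a) ∎
  where open ≡-Reasoning

partialSum≡Δ : ∀ r s k → partialSum r s k ≡ Δ k (λ a _ → ι (r C a) * B (s ℕ.+ a))
partialSum≡Δ r s zero    = trans (sym (ℚ.*-identityˡ (B s))) (cong (λ k → 1ℚ * B k) (sym (ℕ.+-identityʳ s)))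
partialSum≡Δ r s (suc k) = cong (_+ ι (r C suc k) * B (s ℕ.+ suc k)) (partialSum≡Δ r s k)

𝓑≡⋆ : ∀ r s → 𝓑 r s ≡ ((λ a → B (s ℕ.+ a)) ⋆ pow 1ℚ) r
𝓑≡⋆ r s = trans (partialSum≡Δ r s r) (sym (⋆-pow-1 (λ a → B (s ℕ.+ a)) r))

B⋆pow-1 : B ⋆ pow 1ℚ ≗ B ⊕ X
B⋆pow-1 zero          = refl
B⋆pow-1 (suc zero)    = refl
B⋆pow-1 (suc (suc n)) = begin
  (B ⋆ pow 1ℚ) (suc (suc n))
    ≡⟨ ⋆-pow-1 B (suc (suc n)) ⟩
  S + ι (suc (suc n) C suc n) * B (suc n) + ι (suc (suc n) C suc (suc n)) * B (suc (suc n))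
    ≡⟨ cong₂ (λ k l → S + ι k * B (suc n) + ι l * B (suc (suc n))) (C-suc-self (suc n)) (nCn≡1 (suc (suc n))) ⟩
  S + ι (suc (suc n)) * B (suc n) + 1ℚ * B (suc (suc n))
    ≡⟨ cong (λ x → S + ι (suc (suc n)) * x + 1ℚ * B (suc (suc n)))
            (trans (B-suc n) (cong (λ x → - (1/ι-suc (suc n) * x)) (weighted-bernoulliTable (suc (suc n)) n))) ⟩
  S + ι (suc (suc n)) * - (1/ι-suc (suc n) * S) + 1ℚ * B (suc (suc n))
    ≡⟨ regroup S (ι (suc (suc n))) (1/ι-suc (suc n)) (B (suc (suc n))) ⟩
  S - ι (suc (suc n)) * 1/ι-suc (suc n) * S + B (suc (suc n))
    ≡⟨ cong (λ x → S - x * S + B (suc (suc n))) (ι-suc*1/ι-suc (suc n)) ⟩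
  S - 1ℚ * S + B (suc (suc n))
    ≡⟨ cancel S (B (suc (suc n))) ⟩
  B (suc (suc n)) + 0ℚ ∎
  where
  open ≡-Reasoning
  S = Δ n (λ a _ → ι (suc (suc n) C a) * B a)
  regroup : ∀ s c d b → s + c * - (d * s) + 1ℚ * b ≡ s - c * d * s + b
  regroup = solve-∀ ℚ-ring
  cancel : ∀ s b → s - 1ℚ * s + b ≡ b + 0ℚ
  cancel = solve-∀ ℚ-ring

expm1 : Seq
expm1 = pow 1ℚ ⊖ pow 0ℚ

B⋆expm1 : B ⋆ expm1 ≗ X
B⋆expm1 n = begin
  (B ⋆ expm1) n                       ≡⟨ ⋆-distribˡ-⊖ B (pow 1ℚ) (pow 0ℚ) n ⟩
  (B ⋆ pow 1ℚ) n - (B ⋆ pow 0ℚ) n     ≡⟨ cong₂ _-_ (B⋆pow-1 n) (⋆-identityʳ B n) ⟩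
  B n + X n - B n                     ≡⟨ cancel (B n) (X n) ⟩
  X n                                 ∎
  where
  open ≡-Reasoning
  cancel : ∀ b x → b + x - b ≡ x
  cancel = solve-∀ ℚ-ring

sign : ℕ → ℚ
sign zero    = 1ℚ
sign (suc n) = - sign n

sign-+ : ∀ a b → sign (a ℕ.+ b) ≡ sign a * sign b
sign-+ zero    b = sym (ℚ.*-identityˡ (sign b))
sign-+ (suc a) b = trans (cong -_ (sign-+ a b)) (ℚ.neg-distribˡ-* (sign a) (sign b))

-- The coefficients of f(-t).
twist : Seq → Seq
twist f n = sign n * f n

twist-⋆ : ∀ f g → twist (f ⋆ g) ≗ twist f ⋆ twist g
twist-⋆ f g n = begin
  sign n * (f ⋆ g) n                                          ≡⟨ Δ-*ˡ n (sign n) (λ a b → binom a b * (f a * g b)) ⟨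
  Δ n (λ a b → sign n * (binom a b * (f a * g b)))            ≡⟨ Δ-cong n term ⟩
  (twist f ⋆ twist g) n                                       ∎
  where
  open ≡-Reasoning
  regroup : ∀ s t c x y → s * t * (c * (x * y)) ≡ c * (s * x * (t * y))
  regroup = solve-∀ ℚ-ring
  term : ∀ a b → a ℕ.+ b ≡ n → sign n * (binom a b * (f a * g b)) ≡ binom a b * (twist f a * twist g b)
  term a b refl = trans (cong (_* (binom a b * (f a * g b))) (sign-+ a b))
                        (regroup (sign a) (sign b) (binom a b) (f a) (g b))

twist-pow : ∀ x → twist (pow x) ≗ pow (- x)
twist-pow x zero    = refl
twist-pow x (suc n) = trans (regroup (sign n) x (pow x n)) (cong (- x *_) (twist-pow x n))
  where
  regroup : ∀ s x p → - s * (x * p) ≡ - x * (s * p)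
  regroup = solve-∀ ℚ-ring

twist-⊖ : ∀ f g → twist (f ⊖ g) ≗ twist f ⊖ twist g
twist-⊖ f g n = distrib (sign n) (f n) (g n)
  where
  distrib : ∀ s x y → s * (x - y) ≡ s * x - s * y
  distrib = solve-∀ ℚ-ring

twist-X : twist X ≗ 𝟘 ⊖ X
twist-X zero          = refl
twist-X (suc zero)    = refl
twist-X (suc (suc n)) = ℚ.*-zeroʳ (sign (suc (suc n)))

twist-expm1 : twist expm1 ≗ pow (- 1ℚ) ⊖ pow 0ℚ
twist-expm1 n = trans (twist-⊖ (pow 1ℚ) (pow 0ℚ) n) (cong₂ _-_ (twist-pow 1ℚ n) (twist-pow 0ℚ n))

twist-B : twist B ≗ B ⊕ X
twist-B = ⋆-cancelʳ w refl {{ℚ.≢-nonZero {w 1} λ ()}} λ n → begin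
  (twist B ⋆ w) n                         ≡⟨ ⋆-congˡ (twist B) (λ k → sym (twist-expm1 k)) n ⟩
  (twist B ⋆ twist expm1) n               ≡⟨ twist-⋆ B expm1 n ⟨
  sign n * (B ⋆ expm1) n                  ≡⟨ cong (sign n *_) (B⋆expm1 n) ⟩
  twist X n                               ≡⟨ twist-X n ⟩
  0ℚ - X n                                ≡⟨ cancel (B n) (X n) ⟨
  B n - (B n + X n)                       ≡⟨ cong₂ _-_ (⋆-identityʳ B n) (B⋆pow-1 n) ⟨
  (B ⋆ pow 0ℚ) n - (B ⋆ pow 1ℚ) n         ≡⟨ ⋆-distribˡ-⊖ B (pow 0ℚ) (pow 1ℚ) n ⟨
  (B ⋆ (pow 0ℚ ⊖ pow 1ℚ)) n               ≡⟨ ⋆-congˡ B pow-1⋆w n ⟨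
  (B ⋆ (pow 1ℚ ⋆ w)) n                    ≡⟨ ⋆-assoc B (pow 1ℚ) w n ⟨
  (B ⋆ pow 1ℚ ⋆ w) n                      ≡⟨ ⋆-congʳ w B⋆pow-1 n ⟩
  ((B ⊕ X) ⋆ w) n                         ∎
  where
  open ≡-Reasoning
  w = pow (- 1ℚ) ⊖ pow 0ℚ
  cancel : ∀ b x → b - (b + x) ≡ 0ℚ - x
  cancel = solve-∀ ℚ-ring
  pow-1⋆w : pow 1ℚ ⋆ w ≗ pow 0ℚ ⊖ pow 1ℚ
  pow-1⋆w n = trans (⋆-distribˡ-⊖ (pow 1ℚ) (pow (- 1ℚ)) (pow 0ℚ) n)
                    (cong₂ _-_ (pow-⋆ 1ℚ (- 1ℚ) n) (⋆-identityʳ (pow 1ℚ) n))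

B-odd : ∀ n → 2 ≤ n → sign n ≡ - 1ℚ → B n ≡ 0ℚ
B-odd (suc (suc n)) _ sign≡-1 = begin
  b                                                 ≡⟨ halve b ⟩
  (b + 0ℚ - - 1ℚ * b) * (ℤ.+ 1 / 2)                 ≡⟨ cong (λ x → (b + 0ℚ - x * b) * (ℤ.+ 1 / 2)) sign≡-1 ⟨
  (b + 0ℚ - sign (suc (suc n)) * b) * (ℤ.+ 1 / 2)   ≡⟨ cong (λ x → (b + 0ℚ - x) * (ℤ.+ 1 / 2)) (twist-B (suc (suc n))) ⟩
  (b + 0ℚ - (b + 0ℚ)) * (ℤ.+ 1 / 2)                 ≡⟨ vanish (b + 0ℚ) ⟩
  0ℚ                                                ∎
  where
  open ≡-Reasoning
  b = B (suc (suc n))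
  halve : ∀ x → x ≡ (x + 0ℚ - - 1ℚ * x) * (ℤ.+ 1 / 2)
  halve = solve-∀ ℚ-ring
  vanish : ∀ x → (x - x) * (ℤ.+ 1 / 2) ≡ 0ℚ
  vanish = solve-∀ ℚ-ring
B-odd (suc zero) (s≤s ()) _

powSum : ℕ → Seq
powSum zero    = 𝟘
powSum (suc N) = powSum N ⊕ pow (ι N)

expm1⋆pow : ∀ x → expm1 ⋆ pow x ≗ pow (1ℚ + x) ⊖ pow x
expm1⋆pow x n = begin
  (expm1 ⋆ pow x) n                           ≡⟨ ⋆-distribʳ-⊖ (pow 1ℚ) (pow 0ℚ) (pow x) n ⟩
  (pow 1ℚ ⋆ pow x) n - (pow 0ℚ ⋆ pow x) n     ≡⟨ cong₂ _-_ (pow-⋆ 1ℚ x n) (⋆-comm (pow 0ℚ) (pow x) n) ⟩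
  pow (1ℚ + x) n - (pow x ⋆ pow 0ℚ) n         ≡⟨ cong (_-_ (pow (1ℚ + x) n)) (⋆-identityʳ (pow x) n) ⟩
  pow (1ℚ + x) n - pow x n                    ∎
  where open ≡-Reasoning

expm1⋆powSum : ∀ N → expm1 ⋆ powSum N ≗ pow (ι N) ⊖ pow 0ℚ
expm1⋆powSum zero    n = trans (⋆-zeroʳ expm1 n) (sym (ℚ.+-inverseʳ (pow 0ℚ n)))
expm1⋆powSum (suc N) n = begin
  (expm1 ⋆ (powSum N ⊕ pow (ι N))) n                              ≡⟨ ⋆-distribˡ-⊕ expm1 (powSum N) (pow (ι N)) n ⟩
  (expm1 ⋆ powSum N) n + (expm1 ⋆ pow (ι N)) n                   ≡⟨ cong₂ _+_ (expm1⋆powSum N n) (expm1⋆pow (ι N) n) ⟩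
  pow (ι N) n - pow 0ℚ n + (pow (1ℚ + ι N) n - pow (ι N) n)      ≡⟨ telescope (pow (ι N) n) (pow 0ℚ n) (pow (1ℚ + ι N) n) ⟩
  pow (1ℚ + ι N) n - pow 0ℚ n                                    ≡⟨ cong (λ x → pow x n - pow 0ℚ n) (ι-suc N) ⟨
  pow (ι (suc N)) n - pow 0ℚ n                                   ∎
  where
  open ≡-Reasoning
  telescope : ∀ x y z → x - y + (z - x) ≡ z - y
  telescope = solve-∀ ℚ-ring

faulhaber : ∀ N m → Δ m (λ a b → binom a (suc b) * (B a * pow (ι N) (suc b))) ≡ ι (suc m) * powSum N m
faulhaber N m = begin
  Δ m (λ a b → binom a (suc b) * (B a * pow (ι N) (suc b)))
    ≡⟨ drop-last (Δ m (λ a b → binom a (suc b) * (B a * pow (ι N) (suc b)))) (binom (suc m) 0) (B (suc m)) ⟩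
  Δ m (λ a b → binom a (suc b) * (B a * pow (ι N) (suc b))) + binom (suc m) 0 * (B (suc m) * 0ℚ)
    ≡⟨ cong (_+ binom (suc m) 0 * (B (suc m) * 0ℚ))
            (Δ-cong m λ a b _ → cong (λ x → binom a (suc b) * (B a * x)) (minus-zero (pow (ι N) (suc b)) (pow 0ℚ b))) ⟩
  (B ⋆ (pow (ι N) ⊖ pow 0ℚ)) (suc m)   ≡⟨ ⋆-congˡ B (λ k → sym (expm1⋆powSum N k)) (suc m) ⟩
  (B ⋆ (expm1 ⋆ powSum N)) (suc m)     ≡⟨ ⋆-assoc B expm1 (powSum N) (suc m) ⟨
  (B ⋆ expm1 ⋆ powSum N) (suc m)       ≡⟨ ⋆-congʳ (powSum N) B⋆expm1 (suc m) ⟩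
  (X ⋆ powSum N) (suc m)               ≡⟨ ⋆-comm X (powSum N) (suc m) ⟩
  (powSum N ⋆ X) (suc m)               ≡⟨ ⋆-X (powSum N) m ⟩
  ι (suc m) * powSum N m               ∎
  where
  open ≡-Reasoning
  drop-last : ∀ s c b → s ≡ s + c * (b * 0ℚ)
  drop-last = solve-∀ ℚ-ring
  minus-zero : ∀ x y → x ≡ x - 0ℚ * y
  minus-zero = solve-∀ ℚ-ring

-- Rationals that are integral at a prime

Integer : ℚ → Set
Integer q = ∃[ x ] ∃[ y ] q ≡ ι x - ι y

integer-ι : ∀ n → Integer (ι n)
integer-ι n = n , 0 , sym (ℚ.+-identityʳ (ι n))

integer-neg : ∀ {q} → Integer q → Integer (- q)
integer-neg {q} (x , y , refl) = y , x , negate (ι x) (ι y)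
  where
  negate : ∀ a b → - (a - b) ≡ b - a
  negate = solve-∀ ℚ-ring

integer-+ : ∀ {q r} → Integer q → Integer r → Integer (q + r)
integer-+ (x , y , refl) (x′ , y′ , refl) = x ℕ.+ x′ , y ℕ.+ y′ , (begin
  ι x - ι y + (ι x′ - ι y′)          ≡⟨ regroup (ι x) (ι y) (ι x′) (ι y′) ⟩
  (ι x + ι x′) - (ι y + ι y′)        ≡⟨ cong₂ _-_ (ι-homo-+ x x′) (ι-homo-+ y y′) ⟨
  ι (x ℕ.+ x′) - ι (y ℕ.+ y′)        ∎)
  where
  open ≡-Reasoning
  regroup : ∀ a b c d → a - b + (c - d) ≡ (a + c) - (b + d)
  regroup = solve-∀ ℚ-ring

integer-* : ∀ {q r} → Integer q → Integer r → Integer (q * r)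
integer-* (x , y , refl) (x′ , y′ , refl) = x ℕ.* x′ ℕ.+ y ℕ.* y′ , x ℕ.* y′ ℕ.+ y ℕ.* x′ , (begin
  (ι x - ι y) * (ι x′ - ι y′)                                  ≡⟨ expand (ι x) (ι y) (ι x′) (ι y′) ⟩
  (ι x * ι x′ + ι y * ι y′) - (ι x * ι y′ + ι y * ι x′)        ≡⟨ cong₂ _-_ (ι-homo-*+* x x′ y y′) (ι-homo-*+* x y′ y x′) ⟨
  ι (x ℕ.* x′ ℕ.+ y ℕ.* y′) - ι (x ℕ.* y′ ℕ.+ y ℕ.* x′)        ∎)
  where
  open ≡-Reasoning
  expand : ∀ a b c d → (a - b) * (c - d) ≡ (a * c + b * d) - (a * d + b * c)
  expand = solve-∀ ℚ-ring
  ι-homo-*+* : ∀ a b c d → ι (a ℕ.* b ℕ.+ c ℕ.* d) ≡ ι a * ι b + ι c * ι d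
  ι-homo-*+* a b c d = trans (ι-homo-+ (a ℕ.* b) (c ℕ.* d)) (cong₂ _+_ (ι-homo-* a b) (ι-homo-* c d))

module Localisation {p : ℕ} (p-prime : Prime p) where

  ∤-* : ∀ {m n} → p ∤ m → p ∤ n → p ∤ m ℕ.* n
  ∤-* {m} {n} p∤m p∤n p∣mn = [ p∤m , p∤n ]′ (euclidsLemma m n p-prime p∣mn)

  ∤-1 : p ∤ 1
  ∤-1 p∣1 = ¬prime[1] (subst Prime (∣1⇒≡1 p∣1) p-prime)

  ∤-^ : ∀ {m} → p ∤ m → ∀ k → p ∤ m ^ k
  ∤-^ p∤m zero    = ∤-1
  ∤-^ p∤m (suc k) = ∤-* p∤m (∤-^ p∤m k)

  record Integral (q : ℚ) : Set where
    constructor integral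
    field
      m       : ℕ
      p∤m     : p ∤ m
      integer : Integer (q * ι m)

  Divisible : ℚ → Set
  Divisible q = ∃[ r ] Integral r × q ≡ ι p * r

  integral-ι : ∀ n → Integral (ι n)
  integral-ι n = integral 1 ∤-1 (subst Integer (sym (ℚ.*-identityʳ (ι n))) (integer-ι n))

  integral-+ : ∀ {q r} → Integral q → Integral r → Integral (q + r)
  integral-+ {q} {r} (integral m p∤m qm) (integral m′ p∤m′ rm′) = integral (m ℕ.* m′) (∤-* p∤m p∤m′)
    (subst Integer (sym eq) (integer-+ (integer-* qm (integer-ι m′)) (integer-* rm′ (integer-ι m))))
    where
    regroup : ∀ q r a b → (q + r) * (a * b) ≡ q * a * b + r * b * a
    regroup = solve-∀ ℚ-ring
    eq : (q + r) * ι (m ℕ.* m′) ≡ q * ι m * ι m′ + r * ι m′ * ι m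
    eq = trans (cong ((q + r) *_) (ι-homo-* m m′)) (regroup q r (ι m) (ι m′))

  integral-* : ∀ {q r} → Integral q → Integral r → Integral (q * r)
  integral-* {q} {r} (integral m p∤m qm) (integral m′ p∤m′ rm′) = integral (m ℕ.* m′) (∤-* p∤m p∤m′)
    (subst Integer (sym eq) (integer-* qm rm′))
    where
    regroup : ∀ q r a b → q * r * (a * b) ≡ q * a * (r * b)
    regroup = solve-∀ ℚ-ring
    eq : q * r * ι (m ℕ.* m′) ≡ q * ι m * (r * ι m′)
    eq = trans (cong (q * r *_) (ι-homo-* m m′)) (regroup q r (ι m) (ι m′))

  integral-neg : ∀ {q} → Integral q → Integral (- q)
  integral-neg {q} (integral m p∤m qm) =
    integral m p∤m (subst Integer (ℚ.neg-distribˡ-* q (ι m)) (integer-neg qm))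

  integral-pow : ∀ {x} n → Integral x → Integral (pow x n)
  integral-pow zero    _  = integral-ι 1
  integral-pow (suc n) ix = integral-* ix (integral-pow n ix)

  divisible-+ : ∀ {q r} → Divisible q → Divisible r → Divisible (q + r)
  divisible-+ (q′ , iq′ , refl) (r′ , ir′ , refl) =
    q′ + r′ , integral-+ iq′ ir′ , sym (ℚ.*-distribˡ-+ (ι p) q′ r′)

  divisible-neg : ∀ {q} → Divisible q → Divisible (- q)
  divisible-neg (q′ , iq′ , refl) = - q′ , integral-neg iq′ , ℚ.neg-distribʳ-* (ι p) q′

  divisible-*ʳ : ∀ {q r} → Divisible q → Integral r → Divisible (q * r)
  divisible-*ʳ {r = r} (q′ , iq′ , refl) ir = q′ * r , integral-* iq′ ir , ℚ.*-assoc (ι p) q′ r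

  divisible-*ˡ : ∀ {q r} → Integral r → Divisible q → Divisible (r * q)
  divisible-*ˡ {q} {r} ir dq = subst Divisible (ℚ.*-comm q r) (divisible-*ʳ dq ir)

  divisible⇒integral : ∀ {q} → Divisible q → Integral q
  divisible⇒integral (q′ , iq′ , refl) = integral-* (integral-ι p) iq′

  divisible-Δ : ∀ n F → (∀ a b → a ℕ.+ b ≡ n → Divisible (F a b)) → Divisible (Δ n F)
  divisible-Δ = Δ-closed Divisible divisible-+

  divisible-ι⇒∣ : ∀ {n} → Divisible (ι n) → p ∣ n
  divisible-ι⇒∣ {n} (r , integral m p∤m (x , y , rm≡x-y) , ιn≡pr) =
    [ id , ⊥-elim ∘ p∤m ]′ (euclidsLemma n m p-prime p∣nm)
    where
    open ≡-Reasoning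
    cancel : ∀ p x y → p * (x - y) + p * y ≡ p * x
    cancel = solve-∀ ℚ-ring
    nm+py≡px : n ℕ.* m ℕ.+ p ℕ.* y ≡ p ℕ.* x
    nm+py≡px = ι-injective (begin
      ι (n ℕ.* m ℕ.+ p ℕ.* y)          ≡⟨ ι-homo-+ (n ℕ.* m) (p ℕ.* y) ⟩
      ι (n ℕ.* m) + ι (p ℕ.* y)        ≡⟨ cong₂ _+_ (ι-homo-* n m) (ι-homo-* p y) ⟩
      ι n * ι m + ι p * ι y            ≡⟨ cong (λ z → z * ι m + ι p * ι y) ιn≡pr ⟩
      ι p * r * ι m + ι p * ι y        ≡⟨ cong (_+ ι p * ι y) (trans (ℚ.*-assoc (ι p) r (ι m)) (cong (ι p *_) rm≡x-y)) ⟩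
      ι p * (ι x - ι y) + ι p * ι y    ≡⟨ cancel (ι p) (ι x) (ι y) ⟩
      ι p * ι x                        ≡⟨ ι-homo-* p x ⟨
      ι (p ℕ.* x)                      ∎)
    p∣nm : p ∣ n ℕ.* m
    p∣nm = ∣m+n∣m⇒∣n (subst (p ∣_) (trans (sym nm+py≡px) (ℕ.+-comm (n ℕ.* m) (p ℕ.* y))) (m∣m*n x)) (m∣m*n y)

  1<p : 1 < p
  1<p = ℕ.nonTrivial⇒n>1 p {{prime⇒nonTrivial p-prime}}

  instance
    p≢0 : NonZero p
    p≢0 = prime⇒nonZero p-prime

  p-part : ∀ n → NonZero n → ∃[ v ] ∃[ u ] p ∤ u × n ≡ p ^ v ℕ.* u
  p-part = <-rec _ step
    where
    step : ∀ n → (∀ {k} → k < n → NonZero k → ∃[ v ] ∃[ u ] p ∤ u × k ≡ p ^ v ℕ.* u) →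
           NonZero n → ∃[ v ] ∃[ u ] p ∤ u × n ≡ p ^ v ℕ.* u
    step n rec n≢0 with p ∣? n
    ... | no p∤n = 0 , n , p∤n , sym (ℕ.*-identityˡ n)
    ... | yes (divides zero n≡0) = ⊥-elim (ℕ.≢-nonZero⁻¹ n {{n≢0}} n≡0)
    ... | yes (divides k@(suc _) n≡k*p) with rec (subst (k <_) (sym n≡k*p) (ℕ.m<m*n k p 1<p)) _
    ...   | v , u , p∤u , k≡p^v*u = suc v , u , p∤u , (begin
      n                       ≡⟨ n≡k*p ⟩
      k ℕ.* p                 ≡⟨ cong (ℕ._* p) k≡p^v*u ⟩
      p ^ v ℕ.* u ℕ.* p       ≡⟨ regroup (p ^ v) u p ⟩
      p ℕ.* p ^ v ℕ.* u       ∎)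
      where
      open ≡-Reasoning
      regroup : ∀ a b c → a ℕ.* b ℕ.* c ≡ c ℕ.* a ℕ.* b
      regroup = ℕ-solve-∀

  integral-/ : ∀ x u → p ∤ suc u → Integral (ι x * 1/ι-suc u)
  integral-/ x u p∤u =
    integral (suc u) p∤u (subst Integer (sym (*1/ι-suc*ι-suc (ι x) u)) (integer-ι x))

  [2+b]<p^[1+b] : 2 < p → ∀ b → 2 ℕ.+ b < p ^ suc b
  [2+b]<p^[1+b] 2<p zero    = subst (2 <_) (sym (ℕ.*-identityʳ p)) 2<p
  [2+b]<p^[1+b] 2<p (suc b) = begin-strict
    3 ℕ.+ b           ≤⟨ [2+b]<p^[1+b] 2<p b ⟩
    p ^ suc b         <⟨ ℕ.m<m*n (p ^ suc b) p {{ℕ.m^n≢0 p (suc b)}} 1<p ⟩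
    p ^ suc b ℕ.* p   ≡⟨ ℕ.*-comm (p ^ suc b) p ⟩
    p ^ suc (suc b)   ∎
    where open ℕ.≤-Reasoning

  p-part-bound : 2 < p → ∀ b v u → NonZero u → 2 ℕ.+ b ≡ p ^ v ℕ.* u → v ≤ b
  p-part-bound 2<p b v u u≢0 2+b≡p^v*u = ℕ.≮⇒≥ λ b<v → ℕ.<-irrefl refl (begin-strict
    p ^ suc b         ≤⟨ ℕ.^-monoʳ-≤ p b<v ⟩
    p ^ v             ≤⟨ ℕ.m≤m*n (p ^ v) u {{u≢0}} ⟩
    p ^ v ℕ.* u       ≡⟨ 2+b≡p^v*u ⟨
    2 ℕ.+ b           <⟨ [2+b]<p^[1+b] 2<p b ⟩
    p ^ suc b         ∎)
    where open ℕ.≤-Reasoning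

  -- Writing 2 + b = pᵛu with p ∤ u, the quotient is p · p^(b−v)/u, and v ≤ b.
  divisible-p^[1+b]/[2+b] : 2 < p → ∀ b → Divisible (pow (ι p) (suc b) * 1/ι-suc (suc b))
  divisible-p^[1+b]/[2+b] 2<p b with p-part (2 ℕ.+ b) _
  ... | v , zero  , p∤0 , _         = ⊥-elim (p∤0 (p ∣0))
  ... | v , suc u , p∤u , 2+b≡p^v*u with ℕ.m≤n⇒∃[o]m+o≡n (p-part-bound 2<p b v (suc u) _ 2+b≡p^v*u)
  ...   | w , refl = q , integral-/ (p ^ w) u p∤u ,
    *-cancelʳ-nonZero (ι (2 ℕ.+ b)) {{ι-suc-nonZero (suc b)}} (begin
      pow (ι p) (suc b) * 1/ι-suc (suc b) * ι (2 ℕ.+ b)   ≡⟨ *1/ι-suc*ι-suc (pow (ι p) (suc b)) (suc b) ⟩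
      pow (ι p) (suc b)                                   ≡⟨ pow-ι p (suc b) ⟩
      ι (p ℕ.* p ^ (v ℕ.+ w))                             ≡⟨ cong (λ k → ι (p ℕ.* k)) (ℕ.^-distribˡ-+-* p v w) ⟩
      ι (p ℕ.* (p ^ v ℕ.* p ^ w))                         ≡⟨ ι-homo-* p (p ^ v ℕ.* p ^ w) ⟩
      ι p * ι (p ^ v ℕ.* p ^ w)                           ≡⟨ cong (ι p *_) (ι-homo-* (p ^ v) (p ^ w)) ⟩
      ι p * (ι (p ^ v) * ι (p ^ w))                       ≡⟨ cong (λ x → ι p * (ι (p ^ v) * x)) (*1/ι-suc*ι-suc (ι (p ^ w)) u) ⟨
      ι p * (ι (p ^ v) * (q * ι (suc u)))                 ≡⟨ regroup (ι p) (ι (p ^ v)) q (ι (suc u)) ⟩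
      ι p * q * (ι (p ^ v) * ι (suc u))                   ≡⟨ cong (ι p * q *_) (ι-homo-* (p ^ v) (suc u)) ⟨
      ι p * q * ι (p ^ v ℕ.* suc u)                       ≡⟨ cong (λ k → ι p * q * ι k) 2+b≡p^v*u ⟨
      ι p * q * ι (2 ℕ.+ (v ℕ.+ w))                       ∎)
    where
    open ≡-Reasoning
    q = ι (p ^ w) * 1/ι-suc u
    regroup : ∀ a b c d → a * (b * (c * d)) ≡ a * c * (b * d)
    regroup = solve-∀ ℚ-ring

-- The von Staudt–Clausen congruence at 3

3-prime : Prime 3
3-prime = from-yes (prime? 3)

open Localisation 3-prime

integral-powSum : ∀ N m → Integral (powSum N m)
integral-powSum zero    m = integral-ι 0
integral-powSum (suc N) m = integral-+ (integral-powSum N m) (integral-pow m (integral-ι N))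

-- Faulhaber's formula for N = 3, divided by n + 1, gives
-- 3Bₙ − (0ⁿ + 1ⁿ + 2ⁿ) = −Σ_{k<n} C(n, k) 3^(n−k)/(n + 1 − k) · 3Bₖ, a sum in 3ℤ₍₃₎ by induction.
3B≡powSum : ∀ n → Divisible (ι 3 * B n - powSum 3 n)
3B≡powSum = <-rec _ step
  where
  step : ∀ n → (∀ {a} → a < n → Divisible (ι 3 * B a - powSum 3 a)) → Divisible (ι 3 * B n - powSum 3 n)
  step zero    _  = 0ℚ , integral-ι 0 , refl
  step (suc m) ih = subst Divisible −ΔT≡3B-powSum (divisible-neg (divisible-Δ m T divisible-T))
    where
    open ≡-Reasoning
    n = suc m
    K = ι (suc n)
    F T : ℕ → ℕ → ℚ
    F a b = binom a (suc b) * (B a * pow (ι 3) (suc b))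
    T a b = binom a (suc b) * (pow (ι 3) (suc b) * 1/ι-suc (suc b)) * (ι 3 * B a)

    integral-3B : ∀ {a} → a < n → Integral (ι 3 * B a)
    integral-3B {a} a<n = subst Integral (sub-add (ι 3 * B a) (powSum 3 a))
                                (integral-+ (divisible⇒integral (ih a<n)) (integral-powSum 3 a))
      where
      sub-add : ∀ x s → x - s + s ≡ x
      sub-add = solve-∀ ℚ-ring

    divisible-T : ∀ a b → a ℕ.+ b ≡ m → Divisible (T a b)
    divisible-T a b a+b≡m = divisible-*ʳ
      (divisible-*ˡ (integral-ι ((a ℕ.+ suc b) C a)) (divisible-p^[1+b]/[2+b] (s≤s (s≤s (s≤s z≤n))) b))
      (integral-3B (s≤s (subst (a ≤_) a+b≡m (ℕ.m≤m+n a b))))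

    -- Absorbing 1/(b + 2) into the binomial coefficient brings out the factor n + 1.
    F-suc : ∀ a b → a ℕ.+ b ≡ m → F a (suc b) ≡ K * T a b
    F-suc a b refl = *-cancelʳ-nonZero (ι (2 ℕ.+ b)) {{ι-suc-nonZero (suc b)}} (begin
      binom a (2 ℕ.+ b) * (B a * (ι 3 * P)) * ι (2 ℕ.+ b)
        ≡⟨ regroupˡ (binom a (2 ℕ.+ b)) (B a) (ι 3) P (ι (2 ℕ.+ b)) ⟩
      ι (2 ℕ.+ b) * binom a (2 ℕ.+ b) * (ι 3 * B a * P)
        ≡⟨ cong (_* (ι 3 * B a * P)) (binom-absorption a (suc b)) ⟩
      ι (a ℕ.+ (2 ℕ.+ b)) * binom a (suc b) * (ι 3 * B a * P)
        ≡⟨ cong (λ k → ι k * binom a (suc b) * (ι 3 * B a * P)) (trans (ℕ.+-suc a (suc b)) (cong suc (ℕ.+-suc a b))) ⟩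
      K * binom a (suc b) * (ι 3 * B a * P)
        ≡⟨ cong (λ x → K * binom a (suc b) * (ι 3 * B a * x)) (*1/ι-suc*ι-suc P (suc b)) ⟨
      K * binom a (suc b) * (ι 3 * B a * (P * 1/ι-suc (suc b) * ι (2 ℕ.+ b)))
        ≡⟨ regroupʳ K (binom a (suc b)) (ι 3 * B a) P (1/ι-suc (suc b)) (ι (2 ℕ.+ b)) ⟩
      K * T a b * ι (2 ℕ.+ b) ∎)
      where
      P = pow (ι 3) (suc b)
      regroupˡ : ∀ c x t p i → c * (x * (t * p)) * i ≡ i * c * (t * x * p)
      regroupˡ = solve-∀ ℚ-ring
      regroupʳ : ∀ k c y p j i → k * c * (y * (p * j * i)) ≡ k * (c * (p * j) * y) * i
      regroupʳ = solve-∀ ℚ-ring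

    F-last : F n 0 ≡ K * (ι 3 * B n)
    F-last = trans (cong (_* (B n * (ι 3 * 1ℚ))) (binom-oneʳ n)) (regroup K (B n) (ι 3))
      where
      regroup : ∀ k b t → k * (b * (t * 1ℚ)) ≡ k * (t * b)
      regroup = solve-∀ ℚ-ring

    ΔT+3B≡powSum : Δ m T + ι 3 * B n ≡ powSum 3 n
    ΔT+3B≡powSum = *-cancelˡ-nonZero K {{ι-suc-nonZero n}} (begin
      K * (Δ m T + ι 3 * B n)                 ≡⟨ ℚ.*-distribˡ-+ K (Δ m T) (ι 3 * B n) ⟩
      K * Δ m T + K * (ι 3 * B n)             ≡⟨ cong₂ _+_ (Δ-*ˡ m K T) F-last ⟨
      Δ m (λ a b → K * T a b) + F n 0         ≡⟨ cong (_+ F n 0) (Δ-cong m F-suc) ⟨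
      Δ n F                                   ≡⟨ faulhaber 3 n ⟩
      K * powSum 3 n                          ∎)

    −ΔT≡3B-powSum : - Δ m T ≡ ι 3 * B n - powSum 3 n
    −ΔT≡3B-powSum = begin
      - Δ m T                                 ≡⟨ rearrange (Δ m T) (ι 3 * B n) ⟩
      ι 3 * B n - (Δ m T + ι 3 * B n)         ≡⟨ cong (_-_ (ι 3 * B n)) ΔT+3B≡powSum ⟩
      ι 3 * B n - powSum 3 n                  ∎
      where
      rearrange : ∀ d x → - d ≡ x - (d + x)
      rearrange = solve-∀ ℚ-ring

𝟙-even : ℕ → ℚ
𝟙-even zero          = 1ℚ
𝟙-even (suc zero)    = 0ℚ
𝟙-even (suc (suc n)) = 𝟙-even n

𝟙-even-suc+𝟙-even : ∀ n → 𝟙-even (suc n) + 𝟙-even n ≡ 1ℚ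
𝟙-even-suc+𝟙-even zero          = refl
𝟙-even-suc+𝟙-even (suc zero)    = refl
𝟙-even-suc+𝟙-even (suc (suc n)) = 𝟙-even-suc+𝟙-even n

parity : ∀ n → n % 2 ≡ 0 × 𝟙-even n ≡ 1ℚ × sign n ≡ 1ℚ
             ⊎ n % 2 ≡ 1 × 𝟙-even n ≡ 0ℚ × sign n ≡ - 1ℚ
parity zero          = inj₁ (refl , refl , refl)
parity (suc zero)    = inj₂ (refl , refl , refl)
parity (suc (suc n)) with parity n
... | inj₁ (n%2≡0 , e , s) = inj₁ (n%2≡0 , e , trans (neg-involutive (sign n)) s)
... | inj₂ (n%2≡1 , e , s) = inj₂ (n%2≡1 , e , trans (neg-involutive (sign n)) s)

integral-𝟙-even : ∀ n → Integral (𝟙-even n)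
integral-𝟙-even zero          = integral-ι 1
integral-𝟙-even (suc zero)    = integral-ι 0
integral-𝟙-even (suc (suc n)) = integral-𝟙-even n

-- aₙ = 0ⁿ + 1ⁿ + 2ⁿ + [n even] satisfies aₙ₊₁ = 2aₙ − 3[n even] for n ≥ 1.
powSum+𝟙-even : ∀ n → Divisible (powSum 3 (suc n) + 𝟙-even (suc n))
powSum+𝟙-even zero    = 1ℚ , integral-ι 1 , refl
powSum+𝟙-even (suc n) = subst Divisible (sym recurrence)
  (divisible-+ (divisible-*ˡ (integral-ι 2) (powSum+𝟙-even n))
               (divisible-neg (𝟙-even (suc n) , integral-𝟙-even (suc n) , refl)))
  where
  open ≡-Reasoning
  z = pow 0ℚ n
  t = pow (ι 2) (suc n)
  e = 𝟙-even (suc n)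
  recurrence : powSum 3 (suc (suc n)) + 𝟙-even (suc (suc n)) ≡ ι 2 * (powSum 3 (suc n) + e) + - (ι 3 * e)
  recurrence = begin
    0ℚ + 0ℚ * (0ℚ * z) + 1ℚ * pow 1ℚ (suc n) + ι 2 * t + 𝟙-even n
      ≡⟨ cong₂ (λ o e′ → 0ℚ + 0ℚ * (0ℚ * z) + 1ℚ * o + ι 2 * t + e′) (pow-1 (suc n)) 𝟙-even-n ⟩
    0ℚ + 0ℚ * (0ℚ * z) + 1ℚ * 1ℚ + ι 2 * t + (1ℚ - e)
      ≡⟨ regroup z t e ⟩
    ι 2 * (0ℚ + 0ℚ * z + 1ℚ + t + e) + - (ι 3 * e)
      ≡⟨ cong (λ o → ι 2 * (0ℚ + 0ℚ * z + o + t + e) + - (ι 3 * e)) (pow-1 (suc n)) ⟨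
    ι 2 * (powSum 3 (suc n) + e) + - (ι 3 * e) ∎
    where
    regroup : ∀ z t e → 0ℚ + 0ℚ * (0ℚ * z) + 1ℚ * 1ℚ + ι 2 * t + (1ℚ - e)
                      ≡ ι 2 * (0ℚ + 0ℚ * z + 1ℚ + t + e) + - (ι 3 * e)
    regroup = solve-∀ ℚ-ring
    add-sub : ∀ a b → b ≡ a + b - a
    add-sub = solve-∀ ℚ-ring
    𝟙-even-n : 𝟙-even n ≡ 1ℚ - e
    𝟙-even-n = trans (add-sub e (𝟙-even n)) (cong (_- e) (𝟙-even-suc+𝟙-even n))

3B+𝟙-even : ∀ n → Divisible (ι 3 * B (suc n) + 𝟙-even (suc n))
3B+𝟙-even n = subst Divisible (cancel (ι 3 * B (suc n)) (powSum 3 (suc n)) (𝟙-even (suc n)))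
  (divisible-+ (3B≡powSum (suc n)) (powSum+𝟙-even n))
  where
  cancel : ∀ x s e → x - s + (s + e) ≡ x + e
  cancel = solve-∀ ℚ-ring

¬divisible-1 : ¬ Divisible 1ℚ
¬divisible-1 d = ∤-1 (divisible-ι⇒∣ {1} d)

odd≥3⇒B≡0 : ∀ n → 3 ≤ n → n % 2 ≡ 1 → B n ≡ 0ℚ
odd≥3⇒B≡0 n 3≤n n%2≡1 with parity n
... | inj₁ (n%2≡0 , _) = contradiction (trans (sym n%2≡0) n%2≡1) λ ()
... | inj₂ (_ , _ , sign≡-1) = B-odd n (ℕ.<⇒≤ 3≤n) sign≡-1

B≡0⇒odd≥3 : ∀ n → B n ≡ 0ℚ → 3 ≤ n × n % 2 ≡ 1
B≡0⇒odd≥3 zero          ()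
B≡0⇒odd≥3 (suc zero)    ()
B≡0⇒odd≥3 (suc (suc k)) B≡0 with parity (suc (suc k))
... | inj₁ (_ , 𝟙-even≡1 , _) =
  ⊥-elim (¬divisible-1 (subst Divisible (cong₂ (λ b e → ι 3 * b + e) B≡0 𝟙-even≡1) (3B+𝟙-even (suc k))))
... | inj₂ (n%2≡1 , _) with k
...   | zero  = contradiction n%2≡1 λ ()
...   | suc _ = s≤s (s≤s (s≤s z≤n)) , n%2≡1

𝓑-zeroʳ : ∀ r → 𝓑 (suc (suc r)) 0 ≡ B (suc (suc r))
𝓑-zeroʳ r = trans (𝓑≡⋆ (suc (suc r)) 0) (trans (B⋆pow-1 (suc (suc r))) (ℚ.+-identityʳ _))

binomialSum-𝟙-even : ∀ s r → ((λ a → 𝟙-even (s ℕ.+ a)) ⋆ pow 1ℚ) (suc r) ≡ ι (2 ^ r)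
binomialSum-𝟙-even s r = begin
  (E ⋆ pow 1ℚ) (suc r)                          ≡⟨ shift-⋆ E (pow 1ℚ) r ⟩
  (shift E ⋆ pow 1ℚ) r + (E ⋆ 1ℚ · pow 1ℚ) r    ≡⟨ cong ((shift E ⋆ pow 1ℚ) r +_) (⋆-congˡ E 1·pow-1≗pow-1 r) ⟩
  (shift E ⋆ pow 1ℚ) r + (E ⋆ pow 1ℚ) r         ≡⟨ ⋆-distribʳ-⊕ (shift E) E (pow 1ℚ) r ⟨
  ((shift E ⊕ E) ⋆ pow 1ℚ) r                    ≡⟨ ⋆-congʳ (pow 1ℚ) shiftE⊕E≗1 r ⟩
  (pow 1ℚ ⋆ pow 1ℚ) r                           ≡⟨ pow-⋆ 1ℚ 1ℚ r ⟩
  pow (ι 2) r                                   ≡⟨ pow-ι 2 r ⟩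
  ι (2 ^ r)                                     ∎
  where
  open ≡-Reasoning
  E : Seq
  E a = 𝟙-even (s ℕ.+ a)
  1·pow-1≗pow-1 : 1ℚ · pow 1ℚ ≗ pow 1ℚ
  1·pow-1≗pow-1 k = ℚ.*-identityˡ (pow 1ℚ k)
  shiftE⊕E≗1 : shift E ⊕ E ≗ pow 1ℚ
  shiftE⊕E≗1 a = trans (cong (λ k → 𝟙-even k + E a) (ℕ.+-suc s a))
                       (trans (𝟙-even-suc+𝟙-even (s ℕ.+ a)) (sym (pow-1 a)))

𝓑-suc-suc≢0 : ∀ r s → 𝓑 (suc r) (suc s) ≢ 0ℚ
𝓑-suc-suc≢0 r s 𝓑≡0 = ∤-^ 3∤2 r (divisible-ι⇒∣ (subst Divisible sum≡2^r divisible-sum))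
  where
  open ≡-Reasoning
  3∤2 : 3 ∤ 2
  3∤2 = from-no (3 ∣? 2)
  Bₛ E : Seq
  Bₛ a = B (suc s ℕ.+ a)
  E  a = 𝟙-even (suc s ℕ.+ a)
  divisible-sum : Divisible (((ι 3 · Bₛ ⊕ E) ⋆ pow 1ℚ) (suc r))
  divisible-sum = divisible-Δ (suc r) _ λ a b _ →
    divisible-*ˡ (integral-ι ((a ℕ.+ b) C a))
                 (divisible-*ʳ (3B+𝟙-even (s ℕ.+ a)) (integral-pow b (integral-ι 1)))
  sum≡2^r : ((ι 3 · Bₛ ⊕ E) ⋆ pow 1ℚ) (suc r) ≡ ι (2 ^ r)
  sum≡2^r = begin
    ((ι 3 · Bₛ ⊕ E) ⋆ pow 1ℚ) (suc r)                  ≡⟨ ⋆-distribʳ-⊕ (ι 3 · Bₛ) E (pow 1ℚ) (suc r) ⟩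
    (ι 3 · Bₛ ⋆ pow 1ℚ) (suc r) + (E ⋆ pow 1ℚ) (suc r)  ≡⟨ cong₂ _+_ (⋆-·ˡ (ι 3) Bₛ (pow 1ℚ) (suc r))
                                                                       (binomialSum-𝟙-even (suc s) r) ⟩
    ι 3 * (Bₛ ⋆ pow 1ℚ) (suc r) + ι (2 ^ r)            ≡⟨ cong (λ x → ι 3 * x + ι (2 ^ r)) (𝓑≡⋆ (suc r) (suc s)) ⟨
    ι 3 * 𝓑 (suc r) (suc s) + ι (2 ^ r)                ≡⟨ cong (λ x → ι 3 * x + ι (2 ^ r)) 𝓑≡0 ⟩
    ι 3 * 0ℚ + ι (2 ^ r)                               ≡⟨ cong (_+ ι (2 ^ r)) (ℚ.*-zeroʳ (ι 3)) ⟩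
    0ℚ + ι (2 ^ r)                                     ≡⟨ ℚ.+-identityˡ (ι (2 ^ r)) ⟩
    ι (2 ^ r)                                          ∎

theorem1p2 : ∀ (r s : ℕ) →
    (𝓑 r s ≡ 0ℚ) ⇔ (∃[ n ] (3 ≤ n × n % 2 ≡ 1 × ((r ≡ n × s ≡ 0) ⊎ (r ≡ 0 × s ≡ n))))
theorem1p2 r s = mk⇔ (to r s) (from r s)
  where
  to : ∀ r s → 𝓑 r s ≡ 0ℚ → ∃[ n ] (3 ≤ n × n % 2 ≡ 1 × ((r ≡ n × s ≡ 0) ⊎ (r ≡ 0 × s ≡ n)))
  to zero          s       𝓑≡0 = s , proj₁ odd , proj₂ odd , inj₂ (refl , refl)
    where odd = B≡0⇒odd≥3 s 𝓑≡0
  to (suc zero)    zero    ()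
  to (suc (suc r)) zero    𝓑≡0 = suc (suc r) , proj₁ odd , proj₂ odd , inj₁ (refl , refl)
    where odd = B≡0⇒odd≥3 (suc (suc r)) (trans (sym (𝓑-zeroʳ r)) 𝓑≡0)
  to (suc r)       (suc s) 𝓑≡0 = ⊥-elim (𝓑-suc-suc≢0 r s 𝓑≡0)

  from : ∀ r s → ∃[ n ] (3 ≤ n × n % 2 ≡ 1 × ((r ≡ n × s ≡ 0) ⊎ (r ≡ 0 × s ≡ n))) → 𝓑 r s ≡ 0ℚ
  from _ _ (suc (suc k) , 3≤n , odd , inj₁ (refl , refl)) =
    trans (𝓑-zeroʳ k) (odd≥3⇒B≡0 (suc (suc k)) 3≤n odd)
  from _ _ (n           , 3≤n , odd , inj₂ (refl , refl)) = odd≥3⇒B≡0 n 3≤n odd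
  from _ _ (suc zero    , s≤s () , _)
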